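{- Let $n\ge 3$ and let $F_n=\{(2i-1,2i) : 1\le i\le\lfloor n/2\rfloor\}$. Let $R$ be a set of two-layer comparator networks on $n$ channels with first layer $F_n$ containing exactly one representative of each $\approx$-equivalence class of two-layer comparator networks on $n$ channels whose first layer is $F_n$. Then $R$ is a complete set of filters for the optimal-depth sorting network problem on $n$ channels.
   Context: A comparator network on $n$ channels of depth $d$ is a sequence $C=L_1;\ldots;L_d$ of layers; each layer is a set of comparators $(i,j)$, $1\le i<j\le n$, with each channel in at most one comparator of the layer. On an input, comparator $(i,j)$ puts the minimum of the values on channels $i,j$ on channel $i$ and the maximum on channel $j$; untouched channels keep their values. A sorting network sorts every input ascendingly. For networks $C_1,C_2$, $C_1;C_2$ is the concatenation of their layers. Graph representation: $\mathcal G(C)$ has one vertex per comparator of $C$; for a comparator $u$ in layer $k$ and a comparator $v$ in a later layer, there is an edge labeled $1$ (resp. $2$) from $u$ to $v$ if the channel on which $u$ outputs its minimum (resp. maximum) is an input channel of $v$ and no comparator in a layer strictly between those of $u$ and $v$ uses that channel. Write $C_1\approx C_2$ if $\mathcal G(C_1)$ and $\mathcal G(C_2)$ are isomorphic as edge-labeled directed graphs. A set $\mathcal F$ of comparator networks on $n$ channels is a complete set of filters for the optimal-depth sorting network problem if there exists a sorting network on $n$ channels of minimum possible depth of the form $C;C'$ for some $C\in\mathcal F$. -}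

module Defs where

open import Data.Nat as ℕ using (ℕ; zero; suc; _+_; _*_; _⊔_; _⊓_; _/_)
open import Data.Fin as Fin using (Fin; toℕ; _≟_)
open import Data.List using (List; []; _∷_; length; lookup; foldl; _++_)
open import Data.List.Membership.Propositional using (_∈_)
open import Data.List.Relation.Unary.All using (All)
open import Data.List.Relation.Unary.Any using (Any)
open import Data.List.Relation.Unary.AllPairs using (AllPairs)
open import Data.Product using (Σ; ∃; _×_; _,_; proj₁; proj₂)
open import Data.Sum using (_⊎_)
open import Data.Empty using (⊥)
open import Relation.Nullary using (¬_; yes; no)
open import Relation.Binary.PropositionalEquality using (_≡_)
open import Function.Bundles using (_⇔_; _⤖_; Bijection)

-- Channels are Fin n (0-indexed: paper channel c is Fin index c-1).
record Comparator (n : ℕ) : Set where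
  constructor cmp
  field
    lo : Fin n
    hi : Fin n
    lo<hi : lo Fin.< hi
open Comparator public

Touches : ∀ {n} → Comparator n → Fin n → Set
Touches c ch = lo c ≡ ch ⊎ hi c ≡ ch

Disjoint : ∀ {n} → Comparator n → Comparator n → Set
Disjoint c d = ∀ ch → Touches c ch → ¬ Touches d ch

Layer : ℕ → Set
Layer n = List (Comparator n)

ValidLayer : ∀ {n} → Layer n → Set
ValidLayer L = AllPairs Disjoint L

Network : ℕ → Set
Network n = List (Layer n)

ValidNetwork : ∀ {n} → Network n → Set
ValidNetwork C = All ValidLayer C

depth : ∀ {n} → Network n → ℕ
depth = length

applyComp : ∀ {n} → Comparator n → (Fin n → ℕ) → (Fin n → ℕ)
applyComp c x k with k ≟ lo c | k ≟ hi c
... | yes _ | _     = x (lo c) ⊓ x (hi c)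
... | no _  | yes _ = x (lo c) ⊔ x (hi c)
... | no _  | no _  = x k

-- Comparators of a valid layer are disjoint, so sequential application
-- equals simultaneous application.
applyLayer : ∀ {n} → Layer n → (Fin n → ℕ) → (Fin n → ℕ)
applyLayer L x = foldl (λ y c → applyComp c y) x L

run : ∀ {n} → Network n → (Fin n → ℕ) → (Fin n → ℕ)
run C x = foldl (λ y L → applyLayer L y) x C

Sorted : ∀ {n} → (Fin n → ℕ) → Set
Sorted {n} y = ∀ (a b : Fin n) → a Fin.≤ b → y a ℕ.≤ y b

SortingNetwork : ∀ {n} → Network n → Set
SortingNetwork C = ValidNetwork C × (∀ x → Sorted (run C x))

Vertex : ∀ {n} → Network n → Set
Vertex C = Σ (Fin (length C)) λ k → Fin (length (lookup C k))

layerOf : ∀ {n} (C : Network n) → Vertex C → Fin (length C)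
layerOf C = proj₁

compOf : ∀ {n} (C : Network n) → Vertex C → Comparator n
compOf C (k , p) = lookup (lookup C k) p

data Label : Set where
  one two : Label

outChannel : ∀ {n} → Label → Comparator n → Fin n
outChannel one c = lo c
outChannel two c = hi c

Uses : ∀ {n} → Layer n → Fin n → Set
Uses L ch = Any (λ c → Touches c ch) L

Edge : ∀ {n} (C : Network n) → Label → Vertex C → Vertex C → Set
Edge C b u v =
  (toℕ (layerOf C u) ℕ.< toℕ (layerOf C v)) ×
  Touches (compOf C v) (outChannel b (compOf C u)) ×
  (∀ (m : Fin (length C)) → toℕ (layerOf C u) ℕ.< toℕ m → toℕ m ℕ.< toℕ (layerOf C v) →
     ¬ Uses (lookup C m) (outChannel b (compOf C u)))

_≈_ : ∀ {n} → Network n → Network n → Set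
C₁ ≈ C₂ = Σ (Vertex C₁ ⤖ Vertex C₂) λ f →
  ∀ b u v → Edge C₁ b u v ⇔ Edge C₂ b (Bijection.to f u) (Bijection.to f v)

SameNetwork : ∀ {n} → Network n → Network n → Set
SameNetwork C D = Σ (length C ≡ length D) λ _ →
  ∀ (k : Fin (length C)) (m : Fin (length D)) → toℕ k ≡ toℕ m →
    ∀ c → (c ∈ lookup C k) ⇔ (c ∈ lookup D m)

-- F_n = {(2i-1,2i) : 1 ≤ i ≤ ⌊n/2⌋}, 0-indexed: {(2i, 2i+1) : 0 ≤ i < ⌊n/2⌋}.
InFn : ∀ {n} → Comparator n → Set
InFn {n} c = Σ ℕ λ i → (i ℕ.< n / 2) × (toℕ (lo c) ≡ 2 * i) × (toℕ (hi c) ≡ 2 * i + 1)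

FirstLayerIsFn : ∀ {n} → Network n → Set
FirstLayerIsFn [] = ⊥
FirstLayerIsFn (L ∷ _) = ∀ c → c ∈ L ⇔ InFn c

TwoLayerFn : ∀ {n} → Network n → Set
TwoLayerFn C = ValidNetwork C × (depth C ≡ 2) × FirstLayerIsFn C

CompleteFilters : ∀ {n} → (Network n → Set) → Set
CompleteFilters {n} F =
  Σ (Network n) λ C → Σ (Network n) λ C' →
    F C × SortingNetwork (C ++ C') ×
    (∀ (D : Network n) → SortingNetwork D → depth (C ++ C') ℕ.≤ depth D)

module Submission where

-- Take a sorting network of minimum depth (it exists: insertion sort
-- gives some sorting network, sorting is decidable by the 0-1 principle, and
-- valid networks of a fixed depth can be enumerated).  Renaming channels by
-- a permutation, and re-orienting the comparators turned upside down, keeps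
-- a network sorting and keeps its depth ("relabelling").  With relabellings
-- one installs the comparators (2i, 2i+1) one by one in the first layer, so
-- some optimal network C;M has first layer F_n, and it has depth ≥ 2.  If a
-- representative D is isomorphic to C, the isomorphism of graphs induces a
-- channel permutation φ (from the first-layer vertices) that relabels C into
-- D layer by layer; relabelling C;M by φ gives an optimal network D;M'.

open import Defs
open import Data.Bool using (Bool; true; false)
open import Data.Empty using (⊥; ⊥-elim)
open import Data.Fin as Fin using (Fin; toℕ; fromℕ<; _≟_) renaming (zero to fz; suc to fs)
import Data.Fin.Properties as FinP
open import Data.List using (List; []; _∷_; length; lookup; _++_; map; concatMap; allFin)
open import Data.List.Properties using (foldl-++)
open import Data.List.Membership.Propositional using (_∈_; find; lose)
open import Data.List.Membership.Propositional.Properties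
  using (∈-lookup; ∈-allFin; ∈-map⁺; ∈-map⁻; ∈-concatMap⁺; ∈-concatMap⁻)
open import Data.List.Relation.Unary.All as All using (All; []; _∷_)
open import Data.List.Relation.Unary.Any as Any using (Any; here; there; any?)
open import Data.List.Relation.Unary.Any.Properties using (lookup-index)
open import Data.List.Relation.Unary.AllPairs as AllPairs using (AllPairs; []; _∷_)
open import Data.List.Relation.Binary.Pointwise using (Pointwise; []; _∷_)
open import Data.Nat as ℕ using (ℕ; zero; suc; _+_; _*_; _⊔_; _⊓_; _/_; z≤n; s≤s; _≤?_; _≥_)
import Data.Nat.Properties as ℕP
import Data.Nat.DivMod as DivMod
import Data.Vec.Functional as Vector
open import Data.Product using (Σ; _×_; _,_; proj₁; proj₂)
open import Data.Sum using (_⊎_; inj₁; inj₂; [_,_]′)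
open import Function.Bundles using (_⇔_; mk⇔; Equivalence; Bijection)
open import Function.Base using (id; _∘′_)
open import Data.Fin.Permutation using (Permutation′; permutation; _⟨$⟩ʳ_; _⟨$⟩ˡ_; inverseˡ; inverseʳ; transpose; _∘ₚ_)
open import Relation.Binary using (tri<; tri≈; tri>)
open import Relation.Binary.PropositionalEquality
open import Relation.Nullary using (¬_; yes; no; Dec)
open import Relation.Nullary.Decidable using (_⊎-dec_; _→-dec_; _×-dec_; ¬?)

module Semantics where

  module _ {n : ℕ} where

    lo≢hi : (c : Comparator n) → lo c ≢ hi c
    lo≢hi c = FinP.<⇒≢ (lo<hi c)

    channelCases : (c : Comparator n) (i : Fin n) →
                   i ≡ lo c ⊎ (i ≢ lo c × i ≡ hi c) ⊎ (i ≢ lo c × i ≢ hi c)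
    channelCases c i with i ≟ lo c | i ≟ hi c
    ... | yes p | _     = inj₁ p
    ... | no p  | yes q = inj₂ (inj₁ (p , q))
    ... | no p  | no q  = inj₂ (inj₂ (p , q))

    applyComp-lo : (c : Comparator n) (x : Fin n → ℕ) (k : Fin n) →
                   k ≡ lo c → applyComp c x k ≡ x (lo c) ⊓ x (hi c)
    applyComp-lo c x k e with k ≟ lo c
    ... | yes _ = refl
    ... | no ¬e = ⊥-elim (¬e e)

    applyComp-hi : (c : Comparator n) (x : Fin n → ℕ) (k : Fin n) →
                   k ≡ hi c → applyComp c x k ≡ x (lo c) ⊔ x (hi c)
    applyComp-hi c x k e with k ≟ lo c | k ≟ hi c
    ... | yes e' | _     = ⊥-elim (lo≢hi c (trans (sym e') e))
    ... | no _   | yes _ = refl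
    ... | no _   | no ¬e = ⊥-elim (¬e e)

    applyComp-other : (c : Comparator n) (x : Fin n → ℕ) (k : Fin n) →
                      k ≢ lo c → k ≢ hi c → applyComp c x k ≡ x k
    applyComp-other c x k p q with k ≟ lo c | k ≟ hi c
    ... | yes e | _     = ⊥-elim (p e)
    ... | no _  | yes e = ⊥-elim (q e)
    ... | no _  | no _  = refl

    applyComp-untouched : (c : Comparator n) (x : Fin n → ℕ) (k : Fin n) →
                          ¬ Touches c k → applyComp c x k ≡ x k
    applyComp-untouched c x k nt =
      applyComp-other c x k (λ e → nt (inj₁ (sym e))) (λ e → nt (inj₂ (sym e)))

    applyLayer-untouched : (L : Layer n) (x : Fin n → ℕ) (k : Fin n) →
                           ¬ Uses L k → applyLayer L x k ≡ x k
    applyLayer-untouched []      x k nt = refl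
    applyLayer-untouched (c ∷ L) x k nt =
      trans (applyLayer-untouched L (applyComp c x) k (λ u → nt (there u)))
            (applyComp-untouched c x k (λ t → nt (here t)))

    applyComp-cong : (c : Comparator n) {x y : Fin n → ℕ} → (∀ k → x k ≡ y k) →
                     ∀ k → applyComp c x k ≡ applyComp c y k
    applyComp-cong c e k with k ≟ lo c | k ≟ hi c
    ... | yes _ | _     = cong₂ _⊓_ (e (lo c)) (e (hi c))
    ... | no _  | yes _ = cong₂ _⊔_ (e (lo c)) (e (hi c))
    ... | no _  | no _  = e k

    applyLayer-cong : (L : Layer n) {x y : Fin n → ℕ} → (∀ k → x k ≡ y k) →
                      ∀ k → applyLayer L x k ≡ applyLayer L y k
    applyLayer-cong []      e = e
    applyLayer-cong (c ∷ L) e = applyLayer-cong L (applyComp-cong c e)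

    run-cong : (N : Network n) {x y : Fin n → ℕ} → (∀ k → x k ≡ y k) →
               ∀ k → run N x k ≡ run N y k
    run-cong []      e = e
    run-cong (L ∷ N) e = run-cong N (applyLayer-cong L e)

    sorted-resp : {x y : Fin n → ℕ} → (∀ k → x k ≡ y k) → Sorted x → Sorted y
    sorted-resp e s a b a≤b = subst₂ ℕ._≤_ (e a) (e b) (s a b a≤b)

    applyComp-sorted : (c : Comparator n) (x : Fin n → ℕ) → Sorted x →
                       ∀ k → applyComp c x k ≡ x k
    applyComp-sorted c x s k with k ≟ lo c | k ≟ hi c
    ... | yes e | _     = trans (ℕP.m≤n⇒m⊓n≡m (s (lo c) (hi c) (ℕP.<⇒≤ (lo<hi c)))) (cong x (sym e))
    ... | no _  | yes e = trans (ℕP.m≤n⇒m⊔n≡n (s (lo c) (hi c) (ℕP.<⇒≤ (lo<hi c)))) (cong x (sym e))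
    ... | no _  | no _  = refl

    applyLayer-sorted : (L : Layer n) (x : Fin n → ℕ) → Sorted x →
                        ∀ k → applyLayer L x k ≡ x k
    applyLayer-sorted []      x s k = refl
    applyLayer-sorted (c ∷ L) x s k =
      trans (applyLayer-cong L (applyComp-sorted c x s) k) (applyLayer-sorted L x s k)

    run-sorted : (N : Network n) (x : Fin n → ℕ) → Sorted x → ∀ k → run N x k ≡ x k
    run-sorted []      x s k = refl
    run-sorted (L ∷ N) x s k =
      trans (run-cong N (applyLayer-sorted L x s) k) (run-sorted N x s k)

    comparator-ext : {c d : Comparator n} → lo c ≡ lo d → hi c ≡ hi d → c ≡ d
    comparator-ext {cmp a b p} {cmp .a .b q} refl refl = cong (cmp a b) (FinP.<-irrelevant p q)

    touches? : (c : Comparator n) (k : Fin n) → Dec (Touches c k)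
    touches? c k = (lo c ≟ k) ⊎-dec (hi c ≟ k)

    touchesBoth : (c : Comparator n) {x y : Fin n} → Touches c x → Touches c y → x ≢ y →
                  (x ≡ lo c × y ≡ hi c) ⊎ (x ≡ hi c × y ≡ lo c)
    touchesBoth c (inj₁ a) (inj₁ b) x≢y = ⊥-elim (x≢y (trans (sym a) b))
    touchesBoth c (inj₁ a) (inj₂ b) x≢y = inj₁ (sym a , sym b)
    touchesBoth c (inj₂ a) (inj₁ b) x≢y = inj₂ (sym a , sym b)
    touchesBoth c (inj₂ a) (inj₂ b) x≢y = ⊥-elim (x≢y (trans (sym a) b))

    otherEnd : (c : Comparator n) (t : Fin n) → Touches c t → Σ (Fin n) λ p → Touches c p × p ≢ t
    otherEnd c t (inj₁ e) = hi c , inj₂ refl , λ e' → lo≢hi c (trans e (sym e'))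
    otherEnd c t (inj₂ e) = lo c , inj₁ refl , λ e' → lo≢hi c (trans e' (sym e))

    validLayer-lookup : {L : Layer n} → ValidLayer L →
                        ∀ (i j : Fin (length L)) → i Fin.< j → Disjoint (lookup L i) (lookup L j)
    validLayer-lookup (d ∷ _) fz     (fs j) _       = All.lookup d (∈-lookup j)
    validLayer-lookup (_ ∷ v) (fs i) (fs j) (s≤s p) = validLayer-lookup v i j p

    validLayer-unique : {L : Layer n} → ValidLayer L → ∀ {c d ch} →
                        c ∈ L → d ∈ L → Touches c ch → Touches d ch → c ≡ d
    validLayer-unique (_ ∷ _) (here refl) (here refl) tc td = refl
    validLayer-unique (d ∷ _) (here refl) (there m)   tc td = ⊥-elim (All.lookup d m _ tc td)
    validLayer-unique (d ∷ _) (there m)   (here refl) tc td = ⊥-elim (All.lookup d m _ td tc)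
    validLayer-unique (_ ∷ v) (there m)   (there m')  tc td = validLayer-unique v m m' tc td

    validLayer-uniquePos : {L : Layer n} → ValidLayer L → ∀ {p p' k} →
                           Touches (lookup L p) k → Touches (lookup L p') k → p ≡ p'
    validLayer-uniquePos v {p} {p'} {k} t t' with FinP.<-cmp p p'
    ... | tri< lt _ _ = ⊥-elim (validLayer-lookup v p p' lt k t t')
    ... | tri≈ _ e _  = e
    ... | tri> _ _ gt = ⊥-elim (validLayer-lookup v p' p gt k t' t)

    disjoint⇒¬Uses : ∀ {c} {K : Layer n} {k} → All (Disjoint c) K → Touches c k → ¬ Uses K k
    disjoint⇒¬Uses (d ∷ _)  t (here t') = d _ t t'
    disjoint⇒¬Uses {c} {_ ∷ K} (_ ∷ ds) t (there u) = disjoint⇒¬Uses {c} {K} ds t u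

    applyLayer-lo : (L : Layer n) → ValidLayer L → ∀ {c} → c ∈ L →
                    (x : Fin n → ℕ) → applyLayer L x (lo c) ≡ x (lo c) ⊓ x (hi c)
    applyLayer-hi : (L : Layer n) → ValidLayer L → ∀ {c} → c ∈ L →
                    (x : Fin n → ℕ) → applyLayer L x (hi c) ≡ x (lo c) ⊔ x (hi c)

    applyLayer-lo (d ∷ L) (dj ∷ _) (here refl) x =
      trans (applyLayer-untouched L (applyComp d x) (lo d) (disjoint⇒¬Uses {d} {L} dj (inj₁ refl)))
            (applyComp-lo d x (lo d) refl)
    applyLayer-lo (d ∷ L) (dj ∷ v) {c} (there m) x =
      trans (applyLayer-lo L v m (applyComp d x))
            (cong₂ _⊓_ (applyComp-untouched d x (lo c) (λ t → All.lookup dj m (lo c) t (inj₁ refl)))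
                       (applyComp-untouched d x (hi c) (λ t → All.lookup dj m (hi c) t (inj₂ refl))))

    applyLayer-hi (d ∷ L) (dj ∷ _) (here refl) x =
      trans (applyLayer-untouched L (applyComp d x) (hi d) (disjoint⇒¬Uses {d} {L} dj (inj₂ refl)))
            (applyComp-hi d x (hi d) refl)
    applyLayer-hi (d ∷ L) (dj ∷ v) {c} (there m) x =
      trans (applyLayer-hi L v m (applyComp d x))
            (cong₂ _⊔_ (applyComp-untouched d x (lo c) (λ t → All.lookup dj m (lo c) t (inj₁ refl)))
                       (applyComp-untouched d x (hi c) (λ t → All.lookup dj m (hi c) t (inj₂ refl))))

    SameComparators : Layer n → Layer n → Set
    SameComparators L L' = ∀ c → (c ∈ L → c ∈ L') × (c ∈ L' → c ∈ L)

    applyLayer-sameComparators : (L L' : Layer n) → ValidLayer L → ValidLayer L' →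
                                 SameComparators L L' → ∀ x k → applyLayer L x k ≡ applyLayer L' x k
    applyLayer-sameComparators L L' v v' same x k with any? (λ c → touches? c k) L
    ... | yes u with find u
    ...   | c , m , inj₁ refl = trans (applyLayer-lo L v m x) (sym (applyLayer-lo L' v' (proj₁ (same c) m) x))
    ...   | c , m , inj₂ refl = trans (applyLayer-hi L v m x) (sym (applyLayer-hi L' v' (proj₁ (same c) m) x))
    applyLayer-sameComparators L L' v v' same x k | no ¬u =
      trans (applyLayer-untouched L x k ¬u) (sym (applyLayer-untouched L' x k ¬u'))
      where
      ¬u' : ¬ Uses L' k
      ¬u' u' with find u'
      ... | c , m , t = ¬u (lose (proj₂ (same c) m) t)

    replaceTwoLayers : (A B A' B' : Layer n) (M : Network n) → SortingNetwork (A ∷ B ∷ M) →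
                       ValidLayer A' → ValidLayer B' → SameComparators A A' → SameComparators B B' →
                       SortingNetwork (A' ∷ B' ∷ M)
    replaceTwoLayers A B A' B' M ((vA ∷ vB ∷ vM) , sorts) vA' vB' sameA sameB =
      (vA' ∷ vB' ∷ vM) , λ x → sorted-resp (run-cong M (sameOutput x)) (sorts x)
      where
      sameOutput : ∀ x k → applyLayer B (applyLayer A x) k ≡ applyLayer B' (applyLayer A' x) k
      sameOutput x k = trans (applyLayer-cong B (applyLayer-sameComparators A A' vA vA' sameA x) k)
                             (applyLayer-sameComparators B B' vB vB' sameB _ k)

module Relabelling where
  open Semantics

  -- Renaming the channels of a network
  -- by a permutation σ turns some comparators upside down; such a reversed
  -- comparator is replaced by the standard one on the same channels, and the
  -- two channels are swapped in the renaming applied to everything after it.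
  module _ {n : ℕ} where

    perm-injective : (σ : Permutation′ n) {a b : Fin n} → σ ⟨$⟩ʳ a ≡ σ ⟨$⟩ʳ b → a ≡ b
    perm-injective σ {a} {b} e = trans (sym (inverseˡ σ)) (trans (cong (σ ⟨$⟩ˡ_) e) (inverseˡ σ))

    transpose-left : ∀ (a b : Fin n) → transpose a b ⟨$⟩ʳ a ≡ b
    transpose-left a b with a ≟ a
    ... | yes _ = refl
    ... | no ¬p = ⊥-elim (¬p refl)

    transpose-right : ∀ (a b : Fin n) → transpose a b ⟨$⟩ʳ b ≡ a
    transpose-right a b with b ≟ a
    ... | yes e = e
    ... | no _ with b ≟ b
    ...   | yes _ = refl
    ...   | no ¬q = ⊥-elim (¬q refl)

    transpose-other : ∀ (a b k : Fin n) → k ≢ a → k ≢ b → transpose a b ⟨$⟩ʳ k ≡ k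
    transpose-other a b k p q with k ≟ a
    ... | yes e = ⊥-elim (p e)
    ... | no _ with k ≟ b
    ...   | yes e = ⊥-elim (q e)
    ...   | no _  = refl


    Relabels : Permutation′ n → (Fin n → ℕ) → (Fin n → ℕ) → Set
    Relabels σ y z = ∀ i → y (σ ⟨$⟩ʳ i) ≡ z i

    ImageOf : Permutation′ n → Comparator n → Comparator n → Set
    ImageOf σ c c' = (lo c' ≡ σ ⟨$⟩ʳ lo c × hi c' ≡ σ ⟨$⟩ʳ hi c)
                   ⊎ (lo c' ≡ σ ⟨$⟩ʳ hi c × hi c' ≡ σ ⟨$⟩ʳ lo c)

    RelabelStep : Permutation′ n → Comparator n → Comparator n → Permutation′ n → Set
    RelabelStep σ c c' σ' =
      (lo c' ≡ σ ⟨$⟩ʳ lo c × hi c' ≡ σ ⟨$⟩ʳ hi c × (∀ i → σ' ⟨$⟩ʳ i ≡ σ ⟨$⟩ʳ i)) ⊎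
      (lo c' ≡ σ ⟨$⟩ʳ hi c × hi c' ≡ σ ⟨$⟩ʳ lo c ×
       (∀ i → σ' ⟨$⟩ʳ i ≡ transpose (lo c') (hi c') ⟨$⟩ʳ (σ ⟨$⟩ʳ i)))

    relabelStep : (σ : Permutation′ n) (c : Comparator n) →
                  Σ (Comparator n × Permutation′ n) λ r → RelabelStep σ c (proj₁ r) (proj₂ r)
    relabelStep σ c with FinP.<-cmp (σ ⟨$⟩ʳ lo c) (σ ⟨$⟩ʳ hi c)
    ... | tri< p _ _ = (cmp _ _ p , σ) , inj₁ (refl , refl , λ _ → refl)
    ... | tri≈ _ e _ = ⊥-elim (lo≢hi c (perm-injective σ e))
    ... | tri> _ _ p = (cmp _ _ p , σ ∘ₚ transpose (σ ⟨$⟩ʳ hi c) (σ ⟨$⟩ʳ lo c)) , inj₂ (refl , refl , λ _ → refl)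

    relabelComp : Permutation′ n → Comparator n → Comparator n
    relabelComp σ c = proj₁ (proj₁ (relabelStep σ c))

    relabelPerm : Permutation′ n → Comparator n → Permutation′ n
    relabelPerm σ c = proj₂ (proj₁ (relabelStep σ c))

    relabelComp-image : ∀ σ c → ImageOf σ c (relabelComp σ c)
    relabelComp-image σ c with proj₂ (relabelStep σ c)
    ... | inj₁ (l , h , _) = inj₁ (l , h)
    ... | inj₂ (l , h , _) = inj₂ (l , h)

    relabelStep-correct : ∀ σ c c' σ' → RelabelStep σ c c' σ' → ∀ y z → Relabels σ y z →
                          Relabels σ' (applyComp c' y) (applyComp c z)
    relabelStep-correct σ c c' σ' (inj₁ (l , h , σ'≗σ)) y z r i with channelCases c i
    ... | inj₁ p = begin
      applyComp c' y (σ' ⟨$⟩ʳ i)   ≡⟨ applyComp-lo c' y _ (trans (σ'≗σ i) (trans (cong (σ ⟨$⟩ʳ_) p) (sym l))) ⟩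
      y (lo c') ⊓ y (hi c')        ≡⟨ cong₂ _⊓_ (trans (cong y l) (r (lo c))) (trans (cong y h) (r (hi c))) ⟩
      z (lo c) ⊓ z (hi c)          ≡⟨ sym (applyComp-lo c z i p) ⟩
      applyComp c z i              ∎
      where open ≡-Reasoning
    ... | inj₂ (inj₁ (_ , q)) = begin
      applyComp c' y (σ' ⟨$⟩ʳ i)   ≡⟨ applyComp-hi c' y _ (trans (σ'≗σ i) (trans (cong (σ ⟨$⟩ʳ_) q) (sym h))) ⟩
      y (lo c') ⊔ y (hi c')        ≡⟨ cong₂ _⊔_ (trans (cong y l) (r (lo c))) (trans (cong y h) (r (hi c))) ⟩
      z (lo c) ⊔ z (hi c)          ≡⟨ sym (applyComp-hi c z i q) ⟩
      applyComp c z i              ∎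
      where open ≡-Reasoning
    ... | inj₂ (inj₂ (p , q)) = begin
      applyComp c' y (σ' ⟨$⟩ʳ i)   ≡⟨ cong (applyComp c' y) (σ'≗σ i) ⟩
      applyComp c' y (σ ⟨$⟩ʳ i)    ≡⟨ applyComp-other c' y _ (λ e → p (perm-injective σ (trans e l)))
                                                             (λ e → q (perm-injective σ (trans e h))) ⟩
      y (σ ⟨$⟩ʳ i)                 ≡⟨ r i ⟩
      z i                          ≡⟨ sym (applyComp-other c z i p q) ⟩
      applyComp c z i              ∎
      where open ≡-Reasoning
    relabelStep-correct σ c c' σ' (inj₂ (l , h , σ'≗τσ)) y z r i with channelCases c i
    ... | inj₁ p = begin
      applyComp c' y (σ' ⟨$⟩ʳ i)   ≡⟨ applyComp-lo c' y _ lands ⟩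
      y (lo c') ⊓ y (hi c')        ≡⟨ cong₂ _⊓_ (trans (cong y l) (r (hi c))) (trans (cong y h) (r (lo c))) ⟩
      z (hi c) ⊓ z (lo c)          ≡⟨ ℕP.⊓-comm (z (hi c)) (z (lo c)) ⟩
      z (lo c) ⊓ z (hi c)          ≡⟨ sym (applyComp-lo c z i p) ⟩
      applyComp c z i              ∎
      where
      open ≡-Reasoning
      lands : σ' ⟨$⟩ʳ i ≡ lo c'
      lands = trans (σ'≗τσ i) (trans (cong (λ t → transpose (lo c') (hi c') ⟨$⟩ʳ (σ ⟨$⟩ʳ t)) p)
                    (trans (cong (transpose (lo c') (hi c') ⟨$⟩ʳ_) (sym h)) (transpose-right (lo c') (hi c'))))
    ... | inj₂ (inj₁ (_ , q)) = begin
      applyComp c' y (σ' ⟨$⟩ʳ i)   ≡⟨ applyComp-hi c' y _ lands ⟩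
      y (lo c') ⊔ y (hi c')        ≡⟨ cong₂ _⊔_ (trans (cong y l) (r (hi c))) (trans (cong y h) (r (lo c))) ⟩
      z (hi c) ⊔ z (lo c)          ≡⟨ ℕP.⊔-comm (z (hi c)) (z (lo c)) ⟩
      z (lo c) ⊔ z (hi c)          ≡⟨ sym (applyComp-hi c z i q) ⟩
      applyComp c z i              ∎
      where
      open ≡-Reasoning
      lands : σ' ⟨$⟩ʳ i ≡ hi c'
      lands = trans (σ'≗τσ i) (trans (cong (λ t → transpose (lo c') (hi c') ⟨$⟩ʳ (σ ⟨$⟩ʳ t)) q)
                    (trans (cong (transpose (lo c') (hi c') ⟨$⟩ʳ_) (sym l)) (transpose-left (lo c') (hi c'))))
    ... | inj₂ (inj₂ (p , q)) = begin
      applyComp c' y (σ' ⟨$⟩ʳ i)   ≡⟨ cong (applyComp c' y) (trans (σ'≗τσ i) (transpose-other _ _ _ ¬lo ¬hi)) ⟩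
      applyComp c' y (σ ⟨$⟩ʳ i)    ≡⟨ applyComp-other c' y _ ¬lo ¬hi ⟩
      y (σ ⟨$⟩ʳ i)                 ≡⟨ r i ⟩
      z i                          ≡⟨ sym (applyComp-other c z i p q) ⟩
      applyComp c z i              ∎
      where
      open ≡-Reasoning
      ¬lo : σ ⟨$⟩ʳ i ≢ lo c'
      ¬lo e = q (perm-injective σ (trans e l))
      ¬hi : σ ⟨$⟩ʳ i ≢ hi c'
      ¬hi e = p (perm-injective σ (trans e h))

    relabelStep-untouched : ∀ σ c c' σ' → RelabelStep σ c c' σ' →
                            ∀ v → ¬ Touches c v → σ' ⟨$⟩ʳ v ≡ σ ⟨$⟩ʳ v
    relabelStep-untouched σ c c' σ' (inj₁ (_ , _ , σ'≗σ)) v nt = σ'≗σ v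
    relabelStep-untouched σ c c' σ' (inj₂ (l , h , σ'≗τσ)) v nt =
      trans (σ'≗τσ v) (transpose-other (lo c') (hi c') (σ ⟨$⟩ʳ v)
        (λ e → nt (inj₂ (sym (perm-injective σ (trans e l))))) (λ e → nt (inj₁ (sym (perm-injective σ (trans e h))))))

    relabelPerm-untouched : ∀ σ c v → ¬ Touches c v → relabelPerm σ c ⟨$⟩ʳ v ≡ σ ⟨$⟩ʳ v
    relabelPerm-untouched σ c = relabelStep-untouched σ c (relabelComp σ c) (relabelPerm σ c) (proj₂ (relabelStep σ c))

    relabelComp-correct : ∀ σ c y z → Relabels σ y z →
                          Relabels (relabelPerm σ c) (applyComp (relabelComp σ c) y) (applyComp c z)
    relabelComp-correct σ c = relabelStep-correct σ c (relabelComp σ c) (relabelPerm σ c) (proj₂ (relabelStep σ c))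

    relabelLayer : Permutation′ n → Layer n → Layer n × Permutation′ n
    relabelLayer σ []      = [] , σ
    relabelLayer σ (c ∷ L) = relabelComp σ c ∷ proj₁ (relabelLayer (relabelPerm σ c) L)
                           , proj₂ (relabelLayer (relabelPerm σ c) L)

    relabelLayer-correct : ∀ σ (L : Layer n) y z → Relabels σ y z →
                           Relabels (proj₂ (relabelLayer σ L)) (applyLayer (proj₁ (relabelLayer σ L)) y) (applyLayer L z)
    relabelLayer-correct σ []      y z r = r
    relabelLayer-correct σ (c ∷ L) y z r =
      relabelLayer-correct (relabelPerm σ c) L _ _ (relabelComp-correct σ c y z r)

    relabelLayer-untouched : ∀ σ (L : Layer n) v → ¬ Uses L v → proj₂ (relabelLayer σ L) ⟨$⟩ʳ v ≡ σ ⟨$⟩ʳ v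
    relabelLayer-untouched σ []      v nu = refl
    relabelLayer-untouched σ (c ∷ L) v nu =
      trans (relabelLayer-untouched (relabelPerm σ c) L v (λ u → nu (there u)))
            (relabelPerm-untouched σ c v (λ t → nu (here t)))

    ImageOf-cong : ∀ {σ τ c c'} → τ ⟨$⟩ʳ lo c ≡ σ ⟨$⟩ʳ lo c → τ ⟨$⟩ʳ hi c ≡ σ ⟨$⟩ʳ hi c →
                   ImageOf τ c c' → ImageOf σ c c'
    ImageOf-cong p q (inj₁ (l , h)) = inj₁ (trans l p , trans h q)
    ImageOf-cong p q (inj₂ (l , h)) = inj₂ (trans l q , trans h p)

    -- In a valid layer all comparators see the same renaming, so the
    -- relabelled layer is the comparator-wise image of the original one.
    relabelLayer-image : ∀ σ (L : Layer n) → ValidLayer L → Pointwise (ImageOf σ) L (proj₁ (relabelLayer σ L))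
    relabelLayer-image σ []      _        = []
    relabelLayer-image σ (c ∷ L) (dj ∷ v) =
      relabelComp-image σ c ∷ sameRenaming dj (relabelLayer-image (relabelPerm σ c) L v)
      where
      sameRenaming : ∀ {K K'} → All (Disjoint c) K → Pointwise (ImageOf (relabelPerm σ c)) K K' →
                     Pointwise (ImageOf σ) K K'
      sameRenaming []         []       = []
      sameRenaming {d ∷ _} {d' ∷ _} (dd ∷ dds) (im ∷ ims) =
        ImageOf-cong {σ} {relabelPerm σ c} {d} {d'} (relabelPerm-untouched σ c (lo d) (λ t → dd (lo d) t (inj₁ refl)))
                     (relabelPerm-untouched σ c (hi d) (λ t → dd (hi d) t (inj₂ refl))) im
        ∷ sameRenaming dds ims

    image-touches : ∀ {σ d d' ch} → ImageOf σ d d' → Touches d' ch →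
                    Σ (Fin n) λ v → Touches d v × ch ≡ σ ⟨$⟩ʳ v
    image-touches (inj₁ (l , h)) (inj₁ e) = _ , inj₁ refl , trans (sym e) l
    image-touches (inj₁ (l , h)) (inj₂ e) = _ , inj₂ refl , trans (sym e) h
    image-touches (inj₂ (l , h)) (inj₁ e) = _ , inj₂ refl , trans (sym e) l
    image-touches (inj₂ (l , h)) (inj₂ e) = _ , inj₁ refl , trans (sym e) h

    image-disjoint : ∀ {σ c c' d d'} → ImageOf σ c c' → ImageOf σ d d' → Disjoint c d → Disjoint c' d'
    image-disjoint {σ} {c} {c'} {d} {d'} ic id dj ch t t'
      with image-touches {σ} {c} {c'} ic t | image-touches {σ} {d} {d'} id t'
    ... | u , tu , eu | v , tv , ev = dj u tu (subst (Touches d) (perm-injective σ (trans (sym ev) eu)) tv)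

    image-valid : ∀ {σ L L'} → Pointwise (ImageOf σ) L L' → ValidLayer L → ValidLayer L'
    image-valid []         []         = []
    image-valid {σ} {c ∷ _} {c' ∷ _} (ic ∷ ims) (dj ∷ v) = imagesDisjoint ims dj ∷ image-valid {σ} ims v
      where
      imagesDisjoint : ∀ {K K'} → Pointwise (ImageOf σ) K K' → All (Disjoint c) K → All (Disjoint c') K'
      imagesDisjoint []         []         = []
      imagesDisjoint {d ∷ _} {d' ∷ _} (id ∷ ids) (dd ∷ dds) =
        image-disjoint {σ} {c} {c'} {d} {d'} ic id dd ∷ imagesDisjoint ids dds

    relabelNetwork : Permutation′ n → Network n → Network n × Permutation′ n
    relabelNetwork σ []      = [] , σ
    relabelNetwork σ (L ∷ N) = proj₁ (relabelLayer σ L) ∷ proj₁ (relabelNetwork (proj₂ (relabelLayer σ L)) N)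
                             , proj₂ (relabelNetwork (proj₂ (relabelLayer σ L)) N)

    relabelNetwork-correct : ∀ σ (N : Network n) y z → Relabels σ y z →
                             Relabels (proj₂ (relabelNetwork σ N)) (run (proj₁ (relabelNetwork σ N)) y) (run N z)
    relabelNetwork-correct σ []      y z r = r
    relabelNetwork-correct σ (L ∷ N) y z r =
      relabelNetwork-correct (proj₂ (relabelLayer σ L)) N _ _ (relabelLayer-correct σ L y z r)

    relabelNetwork-valid : ∀ σ (N : Network n) → ValidNetwork N → ValidNetwork (proj₁ (relabelNetwork σ N))
    relabelNetwork-valid σ []      []       = []
    relabelNetwork-valid σ (L ∷ N) (v ∷ vs) =
      image-valid {σ} (relabelLayer-image σ L v) v ∷ relabelNetwork-valid (proj₂ (relabelLayer σ L)) N vs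

    relabelNetwork-length : ∀ σ (N : Network n) → length (proj₁ (relabelNetwork σ N)) ≡ length N
    relabelNetwork-length σ []      = refl
    relabelNetwork-length σ (L ∷ N) = cong suc (relabelNetwork-length _ N)

    -- A network whose outputs are always sorted after some fixed renaming τ
    -- already sorts: applied to the sorted input toℕ, which it leaves fixed,
    -- the renaming τ must be order-preserving, hence the identity.
    sortedUpTo⇒sorted : (S : Network n) (τ : Permutation′ n) →
                        (∀ x → Sorted (λ i → run S x (τ ⟨$⟩ʳ i))) → ∀ x → Sorted (run S x)
    sortedUpTo⇒sorted S τ sorts x a b a≤b with FinP.≤-total (τ ⟨$⟩ˡ a) (τ ⟨$⟩ˡ b)
    ... | inj₁ p = subst₂ ℕ._≤_ (cong (run S x) (inverseʳ τ)) (cong (run S x) (inverseʳ τ)) (sorts x _ _ p)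
    ... | inj₂ p = subst (λ t → run S x a ℕ.≤ run S x t) (FinP.≤-antisym a≤b b≤a) ℕP.≤-refl
      where
      onToℕ : toℕ (τ ⟨$⟩ʳ (τ ⟨$⟩ˡ b)) ℕ.≤ toℕ (τ ⟨$⟩ʳ (τ ⟨$⟩ˡ a))
      onToℕ = subst₂ ℕ._≤_ (run-sorted S toℕ (λ _ _ q → q) _) (run-sorted S toℕ (λ _ _ q → q) _) (sorts toℕ _ _ p)
      b≤a : b Fin.≤ a
      b≤a = subst₂ Fin._≤_ (inverseʳ τ) (inverseʳ τ) onToℕ

    relabel-sorting : (σ : Permutation′ n) (N : Network n) → SortingNetwork N →
                      SortingNetwork (proj₁ (relabelNetwork σ N))
    relabel-sorting σ N (valid , sorts) =
      relabelNetwork-valid σ N valid ,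
      sortedUpTo⇒sorted (proj₁ (relabelNetwork σ N)) (proj₂ (relabelNetwork σ N)) λ x →
        sorted-resp (λ i → sym (relabelNetwork-correct σ N x (λ j → x (σ ⟨$⟩ʳ j)) (λ _ → refl) i))
                    (sorts (λ j → x (σ ⟨$⟩ʳ j)))

    pointwise-∈ : ∀ {R : Comparator n → Comparator n → Set} {L L'} → Pointwise R L L' →
                  ∀ {c} → c ∈ L → Σ (Comparator n) λ c' → c' ∈ L' × R c c'
    pointwise-∈ (r ∷ _)  (here refl) = _ , here refl , r
    pointwise-∈ (_ ∷ rs) (there m) with pointwise-∈ rs m
    ... | c' , m' , r = c' , there m' , r

    pointwise-∈' : ∀ {R : Comparator n → Comparator n → Set} {L L'} → Pointwise R L L' →
                   ∀ {c'} → c' ∈ L' → Σ (Comparator n) λ c → c ∈ L × R c c'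
    pointwise-∈' (r ∷ _)  (here refl) = _ , here refl , r
    pointwise-∈' (_ ∷ rs) (there m) with pointwise-∈' rs m
    ... | c , m' , r = c , there m' , r

    ImageOf-onto : ∀ {σ d d'} → ImageOf σ d d' → (u v : Fin n) → u Fin.< v →
                   (σ ⟨$⟩ʳ lo d ≡ u × σ ⟨$⟩ʳ hi d ≡ v) ⊎ (σ ⟨$⟩ʳ lo d ≡ v × σ ⟨$⟩ʳ hi d ≡ u) →
                   lo d' ≡ u × hi d' ≡ v
    ImageOf-onto         (inj₁ (l , h)) u v u<v (inj₁ (x , y)) = trans l x , trans h y
    ImageOf-onto {d' = d'} (inj₁ (l , h)) u v u<v (inj₂ (x , y)) =
      ⊥-elim (ℕP.<-asym u<v (subst₂ Fin._<_ (trans l x) (trans h y) (lo<hi d')))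
    ImageOf-onto {d' = d'} (inj₂ (l , h)) u v u<v (inj₁ (x , y)) =
      ⊥-elim (ℕP.<-asym u<v (subst₂ Fin._<_ (trans l y) (trans h x) (lo<hi d')))
    ImageOf-onto         (inj₂ (l , h)) u v u<v (inj₂ (x , y)) = trans l y , trans h x

module ZeroOne where
  open Semantics

  fromBool : Bool → ℕ
  fromBool true  = 1
  fromBool false = 0

  Monotone : (ℕ → ℕ) → Set
  Monotone f = ∀ {a b} → a ℕ.≤ b → f a ℕ.≤ f b

  threshold : ℕ → ℕ → ℕ
  threshold m t with m ≤? t
  ... | yes _ = 1
  ... | no _  = 0

  threshold-monotone : ∀ m → Monotone (threshold m)
  threshold-monotone m {a} {b} a≤b with m ≤? a | m ≤? b
  ... | yes _   | yes _  = ℕP.≤-refl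
  ... | yes m≤a | no m≰b = ⊥-elim (m≰b (ℕP.≤-trans m≤a a≤b))
  ... | no _    | _      = z≤n

  threshold-≥ : ∀ m t → m ℕ.≤ t → threshold m t ≡ 1
  threshold-≥ m t m≤t with m ≤? t
  ... | yes _  = refl
  ... | no m≰t = ⊥-elim (m≰t m≤t)

  threshold-< : ∀ m t → ¬ m ℕ.≤ t → threshold m t ≡ 0
  threshold-< m t m≰t with m ≤? t
  ... | yes m≤t = ⊥-elim (m≰t m≤t)
  ... | no _    = refl

  module _ {n : ℕ} where

    -- Monotone maps commute with min and max, hence with every network.
    applyComp-monotone : (c : Comparator n) (f : ℕ → ℕ) → Monotone f →
                         (y z : Fin n → ℕ) → (∀ k → y k ≡ f (z k)) → ∀ k → applyComp c y k ≡ f (applyComp c z k)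
    applyComp-monotone c f mono y z e k with channelCases c k
    ... | inj₁ p = begin
      applyComp c y k             ≡⟨ applyComp-lo c y k p ⟩
      y (lo c) ⊓ y (hi c)         ≡⟨ cong₂ _⊓_ (e _) (e _) ⟩
      f (z (lo c)) ⊓ f (z (hi c)) ≡⟨ ℕP.mono-≤-distrib-⊓ mono (z (lo c)) (z (hi c)) ⟨
      f (z (lo c) ⊓ z (hi c))     ≡⟨ cong f (applyComp-lo c z k p) ⟨
      f (applyComp c z k)         ∎
      where open ≡-Reasoning
    ... | inj₂ (inj₁ (_ , q)) = begin
      applyComp c y k             ≡⟨ applyComp-hi c y k q ⟩
      y (lo c) ⊔ y (hi c)         ≡⟨ cong₂ _⊔_ (e _) (e _) ⟩
      f (z (lo c)) ⊔ f (z (hi c)) ≡⟨ ℕP.mono-≤-distrib-⊔ mono (z (lo c)) (z (hi c)) ⟨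
      f (z (lo c) ⊔ z (hi c))     ≡⟨ cong f (applyComp-hi c z k q) ⟨
      f (applyComp c z k)         ∎
      where open ≡-Reasoning
    ... | inj₂ (inj₂ (p , q)) =
      trans (applyComp-other c y k p q) (trans (e k) (cong f (sym (applyComp-other c z k p q))))

    applyLayer-monotone : (L : Layer n) (f : ℕ → ℕ) → Monotone f →
                          (y z : Fin n → ℕ) → (∀ k → y k ≡ f (z k)) →
                          ∀ k → applyLayer L y k ≡ f (applyLayer L z k)
    applyLayer-monotone []      f mono y z e = e
    applyLayer-monotone (c ∷ L) f mono y z e = applyLayer-monotone L f mono _ _ (applyComp-monotone c f mono y z e)

    run-monotone : (N : Network n) (f : ℕ → ℕ) → Monotone f →
                   (y z : Fin n → ℕ) → (∀ k → y k ≡ f (z k)) → ∀ k → run N y k ≡ f (run N z k)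
    run-monotone []      f mono y z e = e
    run-monotone (L ∷ N) f mono y z e = run-monotone N f mono _ _ (applyLayer-monotone L f mono y z e)

    ZeroOne : (Fin n → ℕ) → Set
    ZeroOne x = ∀ k → x k ℕ.≤ 1

    threshold-zeroOne : ∀ m (x : Fin n → ℕ) → ZeroOne (λ k → threshold m (x k))
    threshold-zeroOne m x k with m ≤? x k
    ... | yes _ = ℕP.≤-refl
    ... | no _  = z≤n

    -- The 0-1 principle: a network sorting all 0-1 inputs sorts all inputs.
    -- An unsorted pair of outputs a ≤ b would stay unsorted after
    -- thresholding at the value of output a.
    zeroOnePrinciple : (N : Network n) → (∀ x → ZeroOne x → Sorted (run N x)) → ∀ x → Sorted (run N x)
    zeroOnePrinciple N sorts01 x a b a≤b with run N x a ≤? run N x b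
    ... | yes p = p
    ... | no ¬p = ⊥-elim (1≰0 (subst₂ ℕ._≤_ outA outB (sorts01 x' (threshold-zeroOne m x) a b a≤b)))
      where
      m = run N x a
      x' = λ k → threshold m (x k)
      1≰0 : ¬ (1 ℕ.≤ 0)
      1≰0 ()
      outA : run N x' a ≡ 1
      outA = trans (run-monotone N (threshold m) (threshold-monotone m) x' x (λ _ → refl) a) (threshold-≥ m m ℕP.≤-refl)
      outB : run N x' b ≡ 0
      outB = trans (run-monotone N (threshold m) (threshold-monotone m) x' x (λ _ → refl) b) (threshold-< m _ ¬p)

    toBool : (Fin n → ℕ) → Fin n → Bool
    toBool x k with x k
    ... | zero  = false
    ... | suc _ = true

    fromBool-toBool : (x : Fin n → ℕ) → ZeroOne x → ∀ k → fromBool (toBool x k) ≡ x k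
    fromBool-toBool x x01 k with x k | x01 k
    ... | zero        | _       = refl
    ... | suc zero    | _       = refl
    ... | suc (suc _) | s≤s ()

  consCong : ∀ {m} {b : Bool} {x y : Fin m → Bool} → (∀ k → x k ≡ y k) →
             ∀ k → (b Vector.∷ x) k ≡ (b Vector.∷ y) k
  consCong e fz     = refl
  consCong e (fs k) = e k

  ∀-Bool? : ∀ m (Q : (Fin m → Bool) → Set) → (∀ {x y} → (∀ k → x k ≡ y k) → Q x → Q y) →
            (∀ x → Dec (Q x)) → Dec (∀ x → Q x)
  ∀-Bool? zero Q resp Q? with Q? (λ ())
  ... | yes q  = yes (λ x → resp (λ ()) q)
  ... | no ¬q  = no (λ all → ¬q (all _))
  ∀-Bool? (suc m) Q resp Q?
    with ∀-Bool? m (λ x → Q (true Vector.∷ x))  (λ {x} {y} e → resp (consCong {x = x} {y} e)) (λ x → Q? _)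
       | ∀-Bool? m (λ x → Q (false Vector.∷ x)) (λ {x} {y} e → resp (consCong {x = x} {y} e)) (λ x → Q? _)
  ... | yes allT | yes allF = yes λ x → byHead x (x fz) refl
    where
    byHead : ∀ x b → x fz ≡ b → Q x
    byHead x true  e = resp (λ { fz → sym e ; (fs k) → refl }) (allT (Vector.tail x))
    byHead x false e = resp (λ { fz → sym e ; (fs k) → refl }) (allF (Vector.tail x))
  ... | no ¬allT | _        = no (λ all → ¬allT (λ _ → all _))
  ... | yes _    | no ¬allF = no (λ all → ¬allF (λ _ → all _))

  module _ {n : ℕ} where

    sorted? : (y : Fin n → ℕ) → Dec (Sorted y)
    sorted? y = FinP.all? (λ a → FinP.all? (λ b → (a Fin.≤? b) →-dec (y a ≤? y b)))

    -- By the 0-1 principle it suffices to test the 2ⁿ Boolean inputs.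
    sorts? : (N : Network n) → Dec (∀ x → Sorted (run N x))
    sorts? N with ∀-Bool? n (λ x → Sorted (run N (λ k → fromBool (x k))))
                    (λ e → sorted-resp (run-cong N (λ k → cong fromBool (e k)))) (λ x → sorted? _)
    ... | yes allBool = yes (zeroOnePrinciple N λ x x01 →
                               sorted-resp (run-cong N (fromBool-toBool x x01)) (allBool (toBool x)))
    ... | no ¬allBool = no (λ all → ¬allBool (λ x → all _))

    disjoint? : (c d : Comparator n) → Dec (Disjoint c d)
    disjoint? c d = FinP.all? (λ ch → touches? c ch →-dec ¬? (touches? d ch))

    sortingNetwork? : (N : Network n) → Dec (SortingNetwork N)
    sortingNetwork? N = All.all? (AllPairs.allPairs? disjoint?) N ×-dec sorts? N

module OptimalNetworks where
  open Semantics
  open ZeroOne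

  -- Constructively this needs
  -- (1) some sorting network, (2) decidability of "some sorting network has
  -- depth d", obtained by enumerating the finitely many valid networks of
  -- depth d, and (3) search for the least such d.

  ∈-concatMap : ∀ {A B : Set} {xs : List A} {f : A → List B} {a b} → a ∈ xs → b ∈ f a → b ∈ concatMap f xs
  ∈-concatMap {f = f} a∈xs b∈fa = ∈-concatMap⁺ f (lose a∈xs b∈fa)

  module _ (Q : ℕ → Set) (Q? : ∀ d → Dec (Q d)) where

    LeastWitness : Set
    LeastWitness = Σ ℕ λ d → Q d × (∀ d' → d' ℕ.< d → ¬ Q d')

    private
      searchBelow : ∀ b → LeastWitness ⊎ (∀ d' → d' ℕ.< b → ¬ Q d')
      searchBelow zero = inj₂ (λ _ ())
      searchBelow (suc b) with searchBelow b
      ... | inj₁ w = inj₁ w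
      ... | inj₂ none with Q? b
      ...   | yes q  = inj₁ (b , q , none)
      ...   | no ¬q  = inj₂ λ d' d'<1+b → noneUpTo (ℕP.m≤n⇒m<n∨m≡n (ℕ.s≤s⁻¹ d'<1+b))
        where
        noneUpTo : ∀ {d'} → d' ℕ.< b ⊎ d' ≡ b → ¬ Q d'
        noneUpTo (inj₁ d'<b) = none _ d'<b
        noneUpTo (inj₂ refl) = ¬q

    leastWitness : ∀ k → Q k → LeastWitness
    leastWitness k q with searchBelow (suc k)
    ... | inj₁ w    = w
    ... | inj₂ none = ⊥-elim (none k ℕP.≤-refl q)

  module _ {n : ℕ} where

    comparatorsOn : Fin n → Fin n → List (Comparator n)
    comparatorsOn a b with a Fin.<? b
    ... | yes a<b = cmp a b a<b ∷ []
    ... | no _    = []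

    allComparators : List (Comparator n)
    allComparators = concatMap (λ a → concatMap (comparatorsOn a) (allFin n)) (allFin n)

    allComparators-complete : (c : Comparator n) → c ∈ allComparators
    allComparators-complete c@(cmp a b a<b) =
      ∈-concatMap (∈-allFin a) (∈-concatMap (∈-allFin b) onAB)
      where
      onAB : c ∈ comparatorsOn a b
      onAB with a Fin.<? b
      ... | yes a<b' = here (cong (cmp a b) (FinP.<-irrelevant a<b a<b'))
      ... | no a≮b   = ⊥-elim (a≮b a<b)

    layersOfLength : ℕ → List (Layer n)
    layersOfLength zero    = [] ∷ []
    layersOfLength (suc k) = concatMap (λ c → map (c ∷_) (layersOfLength k)) allComparators

    layersOfLength-complete : (L : Layer n) → L ∈ layersOfLength (length L)
    layersOfLength-complete []      = here refl
    layersOfLength-complete (c ∷ L) =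
      ∈-concatMap (allComparators-complete c) (∈-map⁺ (c ∷_) (layersOfLength-complete L))

    -- A valid layer has at most n comparators: their minimum channels differ.
    validLayer-length : (L : Layer n) → ValidLayer L → length L ℕ.≤ n
    validLayer-length L v = ℕP.≮⇒≥ λ n<len →
      let (i , j , i<j , same) = FinP.pigeonhole n<len (λ i → lo (lookup L i))
      in validLayer-lookup v i j i<j (lo (lookup L i)) (inj₁ refl) (inj₁ (sym same))

    validLayers : List (Layer n)
    validLayers = concatMap (λ i → layersOfLength (toℕ i)) (allFin (suc n))

    validLayers-complete : (L : Layer n) → ValidLayer L → L ∈ validLayers
    validLayers-complete L v =
      ∈-concatMap {f = λ i → layersOfLength (toℕ i)} (∈-allFin (fromℕ< bound))
        (subst (λ t → L ∈ layersOfLength t) (sym (FinP.toℕ-fromℕ< bound)) (layersOfLength-complete L))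
      where
      bound : length L ℕ.< suc n
      bound = s≤s (validLayer-length L v)

    networksOfDepth : ℕ → List (Network n)
    networksOfDepth zero    = [] ∷ []
    networksOfDepth (suc d) = concatMap (λ L → map (L ∷_) (networksOfDepth d)) validLayers

    networksOfDepth-complete : (N : Network n) → ValidNetwork N → N ∈ networksOfDepth (depth N)
    networksOfDepth-complete []      _        = here refl
    networksOfDepth-complete (L ∷ N) (v ∷ vs) =
      ∈-concatMap (validLayers-complete L v) (∈-map⁺ (L ∷_) (networksOfDepth-complete N vs))

    networksOfDepth-depth : ∀ d (N : Network n) → N ∈ networksOfDepth d → depth N ≡ d
    networksOfDepth-depth zero    N (here refl) = refl
    networksOfDepth-depth (suc d) N N∈ with find (∈-concatMap⁻ (λ L → map (L ∷_) (networksOfDepth d)) {validLayers} N∈)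
    ... | L , _ , N∈L∷ with ∈-map⁻ (L ∷_) N∈L∷
    ...   | N' , N'∈ , refl = cong suc (networksOfDepth-depth d N' N'∈)

    SortsAtDepth : ℕ → Set
    SortsAtDepth d = Any SortingNetwork (networksOfDepth d)

    sortsAtDepth? : ∀ d → Dec (SortsAtDepth d)
    sortsAtDepth? d = any? sortingNetwork? (networksOfDepth d)

    sortsAtDepth-intro : (N : Network n) → SortingNetwork N → SortsAtDepth (depth N)
    sortsAtDepth-intro N s = lose (networksOfDepth-complete N (proj₁ s)) s

    sortsAtDepth-elim : ∀ d → SortsAtDepth d → Σ (Network n) λ N → SortingNetwork N × depth N ≡ d
    sortsAtDepth-elim d any with find any
    ... | N , N∈ , s = N , s , networksOfDepth-depth d N N∈

  -- Comparing channel 0 with every other channel puts the minimum on channel 0;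
  -- the remaining channels are then sorted recursively.
  module InsertionSort where

    shiftComp : ∀ {n} → Comparator n → Comparator (suc n)
    shiftComp c = cmp (fs (lo c)) (fs (hi c)) (s≤s (lo<hi c))

    toFront : ∀ {n} → Fin n → Comparator (suc n)
    toFront j = cmp fz (fs j) (s≤s z≤n)

    comparators : (n : ℕ) → List (Comparator n)
    comparators zero    = []
    comparators (suc n) = map toFront (allFin n) ++ map shiftComp (comparators n)

    applyLayer-++ : ∀ {n} (A B : List (Comparator n)) (x : Fin n → ℕ) →
                    applyLayer (A ++ B) x ≡ applyLayer B (applyLayer A x)
    applyLayer-++ A B x = foldl-++ (λ y c → applyComp c y) x A B

    applyComp-shift : ∀ {n} (c : Comparator n) (y : Fin (suc n) → ℕ) (z : Fin n → ℕ) →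
                      (∀ k → y (fs k) ≡ z k) → ∀ k → applyComp (shiftComp c) y (fs k) ≡ applyComp c z k
    applyComp-shift c y z e k with channelCases c k
    ... | inj₁ p = trans (applyComp-lo (shiftComp c) y (fs k) (cong fs p))
                         (trans (cong₂ _⊓_ (e (lo c)) (e (hi c))) (sym (applyComp-lo c z k p)))
    ... | inj₂ (inj₁ (_ , q)) = trans (applyComp-hi (shiftComp c) y (fs k) (cong fs q))
                                      (trans (cong₂ _⊔_ (e (lo c)) (e (hi c))) (sym (applyComp-hi c z k q)))
    ... | inj₂ (inj₂ (p , q)) =
      trans (applyComp-other (shiftComp c) y (fs k) (λ e' → p (FinP.suc-injective e')) (λ e' → q (FinP.suc-injective e')))
            (trans (e k) (sym (applyComp-other c z k p q)))

    applyLayer-shift : ∀ {n} (L : List (Comparator n)) (y : Fin (suc n) → ℕ) (z : Fin n → ℕ) →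
                       (∀ k → y (fs k) ≡ z k) → ∀ k → applyLayer (map shiftComp L) y (fs k) ≡ applyLayer L z k
    applyLayer-shift []      y z e = e
    applyLayer-shift (c ∷ L) y z e = applyLayer-shift L _ _ (applyComp-shift c y z e)

    applyLayer-shift-fz : ∀ {n} (L : List (Comparator n)) (y : Fin (suc n) → ℕ) →
                          applyLayer (map shiftComp L) y fz ≡ y fz
    applyLayer-shift-fz []      y = refl
    applyLayer-shift-fz (c ∷ L) y =
      trans (applyLayer-shift-fz L (applyComp (shiftComp c) y)) (applyComp-other (shiftComp c) y fz (λ ()) (λ ()))

    applyComp-lowerBound : ∀ {n} (c : Comparator n) (y : Fin n → ℕ) m → (∀ k → m ℕ.≤ y k) →
                           ∀ k → m ℕ.≤ applyComp c y k
    applyComp-lowerBound c y m lb k with channelCases c k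
    ... | inj₁ p rewrite applyComp-lo c y k p = ℕP.⊓-glb (lb (lo c)) (lb (hi c))
    ... | inj₂ (inj₁ (_ , q)) rewrite applyComp-hi c y k q = ℕP.≤-trans (lb (lo c)) (ℕP.m≤m⊔n _ _)
    ... | inj₂ (inj₂ (p , q)) rewrite applyComp-other c y k p q = lb k

    applyLayer-lowerBound : ∀ {n} (L : List (Comparator n)) (y : Fin n → ℕ) m → (∀ k → m ℕ.≤ y k) →
                            ∀ k → m ℕ.≤ applyLayer L y k
    applyLayer-lowerBound []      y m lb = lb
    applyLayer-lowerBound (c ∷ L) y m lb = applyLayer-lowerBound L (applyComp c y) m (applyComp-lowerBound c y m lb)

    FrontBelow : ∀ {n} → (Fin (suc n) → ℕ) → (Fin n → Set) → Set
    FrontBelow y S = ∀ j → S j → y fz ℕ.≤ y (fs j)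

    toFront-step : ∀ {n} (j : Fin n) (y : Fin (suc n) → ℕ) (S : Fin n → Set) →
                   FrontBelow y S → FrontBelow (applyComp (toFront j) y) (λ i → i ≡ j ⊎ S i)
    toFront-step j y S below i s rewrite applyComp-lo (toFront j) y fz refl with i ≟ j
    ... | yes refl = ℕP.≤-trans (ℕP.m⊓n≤m _ _) (ℕP.m≤m⊔n _ _)
    ... | no i≢j with s
    ...   | inj₁ i≡j = ⊥-elim (i≢j i≡j)
    ...   | inj₂ si  = ℕP.≤-trans (ℕP.m⊓n≤m _ _) (below i si)

    toFront-all : ∀ {n} (J : List (Fin n)) (y : Fin (suc n) → ℕ) (S : Fin n → Set) → FrontBelow y S →
                  FrontBelow (applyLayer (map toFront J) y) (λ i → i ∈ J ⊎ S i)
    toFront-all []      y S below i (inj₁ ())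
    toFront-all []      y S below i (inj₂ s) = below i s
    toFront-all (j ∷ J) y S below i s =
      toFront-all J (applyComp (toFront j) y) (λ i → i ≡ j ⊎ S i) (toFront-step j y S below) i (regroup s)
      where
      regroup : i ∈ (j ∷ J) ⊎ S i → i ∈ J ⊎ (i ≡ j ⊎ S i)
      regroup (inj₁ (here e))  = inj₂ (inj₁ e)
      regroup (inj₁ (there m)) = inj₁ m
      regroup (inj₂ s)         = inj₂ (inj₂ s)

    comparators-sort : (n : ℕ) (x : Fin n → ℕ) → Sorted (applyLayer (comparators n) x)
    comparators-sort zero    x () b _
    comparators-sort (suc n) x a b a≤b
      rewrite applyLayer-++ (map toFront (allFin n)) (map shiftComp (comparators n)) x = go a b a≤b
      where
      w = applyLayer (map toFront (allFin n)) x
      front : ∀ j → w fz ℕ.≤ w (fs j)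
      front j = toFront-all (allFin n) x (λ _ → ⊥) (λ _ ()) j (inj₁ (∈-allFin j))
      out = applyLayer (map shiftComp (comparators n)) w
      go : ∀ a b → a Fin.≤ b → out a ℕ.≤ out b
      go fz fz _ = ℕP.≤-refl
      go fz (fs b) _ rewrite applyLayer-shift-fz (comparators n) w
                           | applyLayer-shift (comparators n) w (λ k → w (fs k)) (λ _ → refl) b =
        applyLayer-lowerBound (comparators n) (λ k → w (fs k)) (w fz) front b
      go (fs a) (fs b) (s≤s a≤b) rewrite applyLayer-shift (comparators n) w (λ k → w (fs k)) (λ _ → refl) b
                                       | applyLayer-shift (comparators n) w (λ k → w (fs k)) (λ _ → refl) a =
        comparators-sort n (λ k → w (fs k)) a b a≤b

    network : (n : ℕ) → Network n
    network n = map (_∷ []) (comparators n)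

    run-network : ∀ {n} (L : List (Comparator n)) (x : Fin n → ℕ) → run (map (_∷ []) L) x ≡ applyLayer L x
    run-network []      x = refl
    run-network (c ∷ L) x = run-network L (applyComp c x)

    singletons-valid : ∀ {n} (L : List (Comparator n)) → ValidNetwork (map (_∷ []) L)
    singletons-valid []      = []
    singletons-valid (c ∷ L) = ([] ∷ []) ∷ singletons-valid L

    sorting : (n : ℕ) → SortingNetwork (network n)
    sorting n = singletons-valid (comparators n) ,
                λ x → subst Sorted (sym (run-network (comparators n) x)) (comparators-sort n x)

  OptimalSortingNetwork : (n : ℕ) → Network n → Set
  OptimalSortingNetwork n N = SortingNetwork N × (∀ (D : Network n) → SortingNetwork D → depth N ℕ.≤ depth D)

  -- Abstract: its definition runs the exhaustive search, which must never be
  -- unfolded during type checking.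
  abstract
    optimalSortingNetwork : (n : ℕ) → Σ (Network n) (OptimalSortingNetwork n)
    optimalSortingNetwork n
      with leastWitness SortsAtDepth sortsAtDepth?
             (depth (InsertionSort.network n)) (sortsAtDepth-intro _ (InsertionSort.sorting n))
    ... | d , atD , noneBelow with sortsAtDepth-elim d atD
    ...   | N , s , refl = N , s , λ D sD → ℕP.≮⇒≥ λ D<N → noneBelow (depth D) D<N (sortsAtDepth-intro D sD)

module Pairs where
  open Semantics

  2*[n/2]≤n : ∀ n → 2 * (n / 2) ℕ.≤ n
  2*[n/2]≤n n = subst (ℕ._≤ n) (ℕP.*-comm (n / 2) 2) (DivMod.m/n*n≤m n 2)

  n≤2*[n/2]+1 : ∀ n → n ℕ.≤ 2 * (n / 2) + 1
  n≤2*[n/2]+1 n = subst₂ ℕ._≤_ (sym (DivMod.m≡m%n+[m/n]*n n 2))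
                    (trans (ℕP.+-comm 1 ((n / 2) * 2)) (cong (_+ 1) (ℕP.*-comm (n / 2) 2)))
                    (ℕP.+-monoˡ-≤ ((n / 2) * 2) (ℕ.s≤s⁻¹ (DivMod.m%n<n n 2)))

  2j+1<2i : ∀ {j i} → j ℕ.< i → 2 * j + 1 ℕ.< 2 * i
  2j+1<2i {j} {i} j<i =
    subst (ℕ._≤ 2 * i) (sym (trans (cong suc (ℕP.+-comm (2 * j) 1)) (sym (ℕP.*-suc 2 j)))) (ℕP.*-monoʳ-≤ 2 j<i)

  2i<2i+1 : ∀ i → 2 * i ℕ.< 2 * i + 1
  2i<2i+1 i = subst (2 * i ℕ.<_) (ℕP.+-comm 1 (2 * i)) (ℕP.n<1+n _)

  pair-bound : ∀ {n i} → i ℕ.< n / 2 → 2 * i + 1 ℕ.< n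
  pair-bound {n} i<h = ℕP.<-≤-trans (2j+1<2i i<h) (2*[n/2]≤n n)

  halve : ∀ l → Σ ℕ λ j → l ≡ 2 * j ⊎ l ≡ 2 * j + 1
  halve zero = 0 , inj₁ refl
  halve (suc l) with halve l
  ... | j , inj₁ e = j , inj₂ (trans (cong suc e) (ℕP.+-comm 1 (2 * j)))
  ... | j , inj₂ e = suc j , inj₁ (trans (cong suc e) (trans (cong suc (ℕP.+-comm (2 * j) 1)) (sym (ℕP.*-suc 2 j))))

  module _ {n : ℕ} where

    InPair : ℕ → Fin n → Set
    InPair j x = toℕ x ≡ 2 * j ⊎ toℕ x ≡ 2 * j + 1

    InPair-≤ : ∀ {j x} → InPair j x → toℕ x ℕ.≤ 2 * j + 1
    InPair-≤ {j} (inj₁ e) = subst (ℕ._≤ 2 * j + 1) (sym e) (ℕP.m≤m+n (2 * j) 1)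
    InPair-≤     (inj₂ e) = ℕP.≤-reflexive e

    InPair-≥ : ∀ {j x} → InPair j x → 2 * j ℕ.≤ toℕ x
    InPair-≥     (inj₁ e) = ℕP.≤-reflexive (sym e)
    InPair-≥ {j} (inj₂ e) = subst (2 * j ℕ.≤_) (sym e) (ℕP.m≤m+n (2 * j) 1)

    pairs-disjoint : ∀ {j i} → j ℕ.< i → ∀ {x y : Fin n} → InPair j x → InPair i y → x ≢ y
    pairs-disjoint {j} {i} j<i ix iy refl =
      ℕP.<-irrefl refl (ℕP.≤-<-trans (InPair-≤ {j} ix) (ℕP.<-≤-trans (2j+1<2i j<i) (InPair-≥ {i} iy)))

    pairIndex : ∀ (k : Fin n) → toℕ k ℕ.< 2 * (n / 2) → Σ ℕ λ j → j ℕ.< n / 2 × InPair j k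
    pairIndex k k<2h with halve (toℕ k)
    ... | j , inK = j , ℕP.*-cancelˡ-< 2 j (n / 2) (ℕP.≤-<-trans (InPair-≥ {j} inK) k<2h) , inK

    -- Only the last channel of an odd number of channels lies outside all pairs,
    -- so every minimum channel lies in a pair.
    lo<2*[n/2] : ∀ (d : Comparator n) → toℕ (lo d) ℕ.< 2 * (n / 2)
    lo<2*[n/2] d = ℕ.s≤s⁻¹ (subst (suc (suc (toℕ (lo d))) ℕ.≤_) (ℕP.+-comm (2 * (n / 2)) 1)
                     (ℕP.≤-trans (s≤s (lo<hi d)) (ℕP.≤-trans (FinP.toℕ<n (hi d)) (n≤2*[n/2]+1 n))))

    pairComp : ∀ i → i ℕ.< n / 2 → Comparator n
    pairComp i i<h = cmp (fromℕ< (ℕP.<-trans (2i<2i+1 i) (pair-bound i<h))) (fromℕ< (pair-bound i<h))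
      (subst₂ ℕ._<_ (sym (FinP.toℕ-fromℕ< _)) (sym (FinP.toℕ-fromℕ< _)) (2i<2i+1 i))

    pairComp-lo : ∀ i (i<h : i ℕ.< n / 2) → toℕ (lo (pairComp i i<h)) ≡ 2 * i
    pairComp-lo i i<h = FinP.toℕ-fromℕ< _

    pairComp-hi : ∀ i (i<h : i ℕ.< n / 2) → toℕ (hi (pairComp i i<h)) ≡ 2 * i + 1
    pairComp-hi i i<h = FinP.toℕ-fromℕ< _

    pairComp-InFn : ∀ i (i<h : i ℕ.< n / 2) → InFn (pairComp i i<h)
    pairComp-InFn i i<h = i , i<h , pairComp-lo i i<h , pairComp-hi i i<h

    pairComp-touches : ∀ i (i<h : i ℕ.< n / 2) {k} → InPair i k → Touches (pairComp i i<h) k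
    pairComp-touches i i<h (inj₁ e) = inj₁ (FinP.toℕ-injective (trans (pairComp-lo i i<h) (sym e)))
    pairComp-touches i i<h (inj₂ e) = inj₂ (FinP.toℕ-injective (trans (pairComp-hi i i<h) (sym e)))

module FirstLayer where
  open Semantics
  open Relabelling
  open Pairs

  -- The
  -- comparators (2i, 2i+1) are installed one at a time; when channel 2i or
  -- 2i+1 is used by a comparator c of the first layer reaching outside the
  -- pair, the network is relabelled by the transposition that moves the other
  -- end of c into the pair.  This fixes all pairs installed before.
  module _ {n : ℕ} where

    ContainsPairs : Layer n → ℕ → Set
    ContainsPairs L i = ∀ j → j ℕ.< i →
      Σ (Comparator n) λ c → c ∈ L × toℕ (lo c) ≡ 2 * j × toℕ (hi c) ≡ 2 * j + 1

    NormalisedUpTo : ℕ → Layer n → Network n → Set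
    NormalisedUpTo i L M = Σ (Layer n) λ L' → Σ (Network n) λ M' →
      SortingNetwork (L' ∷ M') × length M' ≡ length M × ContainsPairs L' i

    addComparator : (c : Comparator n) (L : Layer n) (M : Network n) → All (Disjoint c) L →
                    SortingNetwork (L ∷ M) → SortingNetwork ((c ∷ L) ∷ M)
    addComparator c L M dj ((v ∷ vs) , sorts) = ((dj ∷ v) ∷ vs) , λ x → sorts (applyComp c x)

    module AddPair (i : ℕ) (i<h : i ℕ.< n / 2) where

      a b : Fin n
      a = lo (pairComp i i<h)
      b = hi (pairComp i i<h)

      a<b : a Fin.< b
      a<b = lo<hi (pairComp i i<h)

      a∈pair : InPair i a
      a∈pair = inj₁ (pairComp-lo i i<h)

      b∈pair : InPair i b
      b∈pair = inj₂ (pairComp-hi i i<h)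

      containsPairs-extend : ∀ {L} (c : Comparator n) → c ∈ L → lo c ≡ a → hi c ≡ b →
                             ContainsPairs L i → ContainsPairs L (suc i)
      containsPairs-extend c m la hb has j j<1+i with ℕP.m≤n⇒m<n∨m≡n (ℕ.s≤s⁻¹ j<1+i)
      ... | inj₁ j<i  = has j j<i
      ... | inj₂ refl = c , m , trans (cong toℕ la) (pairComp-lo i i<h) , trans (cong toℕ hb) (pairComp-hi i i<h)

      addUnusedPair : ∀ L M → SortingNetwork (L ∷ M) → ContainsPairs L i →
                      ¬ Uses L a → ¬ Uses L b → NormalisedUpTo (suc i) L M
      addUnusedPair L M s has ¬ua ¬ub =
        (pairComp i i<h ∷ L) , M , addComparator _ L M (disjointFrom L ¬ua ¬ub) s , refl ,
        containsPairs-extend _ (here refl) refl refl (λ j j<i → let (c , m , e) = has j j<i in c , there m , e)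
        where
        disjointFrom : ∀ K → ¬ Uses K a → ¬ Uses K b → All (Disjoint (pairComp i i<h)) K
        disjointFrom []      _    _    = []
        disjointFrom (d ∷ K) ¬ua' ¬ub' =
          (λ { ch (inj₁ refl) td → ¬ua' (here td) ; ch (inj₂ refl) td → ¬ub' (here td) })
          ∷ disjointFrom K (λ u → ¬ua' (there u)) (λ u → ¬ub' (there u))

      -- The comparator c ∈ L touches t ∈ {a, b} and leaves the pair at its other
      -- end p.  Relabelling by the transposition (p t'), where {t, t'} = {a, b},
      -- turns c into (a, b) and fixes the pairs j < i.
      swapIntoPair : ∀ L M → SortingNetwork (L ∷ M) → ContainsPairs L i → (t t' : Fin n) →
                     InPair i t → InPair i t' → t ≢ t' → (t ≡ a × t' ≡ b) ⊎ (t ≡ b × t' ≡ a) →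
                     (c : Comparator n) → c ∈ L → Touches c t → (p : Fin n) → Touches c p →
                     p ≢ t → p ≢ t' → NormalisedUpTo (suc i) L M
      swapIntoPair L M s has t t' t∈ t'∈ t≢t' tt' c c∈L tc p tp p≢t p≢t' =
        L' , M' , relabel-sorting σ (L ∷ M) s , relabelNetwork-length _ M , has'
        where
        σ = transpose p t'
        L' = proj₁ (relabelLayer σ L)
        M' = proj₁ (relabelNetwork (proj₂ (relabelLayer σ L)) M)
        vL = All.head (proj₁ s)
        images = relabelLayer-image σ L vL
        -- The channels of an installed pair j < i are neither t' nor p: p is
        -- the end of c, which touches the pair i, not the pair j.
        fixesPair : ∀ j → j ℕ.< i → ∀ (d : Comparator n) → d ∈ L → InPair j (lo d) → InPair j (hi d) →
                    σ ⟨$⟩ʳ lo d ≡ lo d × σ ⟨$⟩ʳ hi d ≡ hi d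
        fixesPair j j<i d d∈L lj hj =
          transpose-other p t' (lo d) (≢p (inj₁ refl) lj) (pairs-disjoint j<i lj t'∈) ,
          transpose-other p t' (hi d) (≢p (inj₂ refl) hj) (pairs-disjoint j<i hj t'∈)
          where
          ≢p : ∀ {x} → Touches d x → InPair j x → x ≢ p
          ≢p tx jx refl with validLayer-unique vL c∈L d∈L tp tx
          ... | refl = notInPairI tc
            where
            notInPairI : ¬ Touches c t
            notInPairI (inj₁ e) = pairs-disjoint j<i (subst (InPair j) e lj) t∈ refl
            notInPairI (inj₂ e) = pairs-disjoint j<i (subst (InPair j) e hj) t∈ refl
        σt : σ ⟨$⟩ʳ t ≡ t
        σt = transpose-other p t' t (λ e → p≢t (sym e)) t≢t'
        σp : σ ⟨$⟩ʳ p ≡ t'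
        σp = transpose-left p t'
        c↦pair : (σ ⟨$⟩ʳ lo c ≡ a × σ ⟨$⟩ʳ hi c ≡ b) ⊎ (σ ⟨$⟩ʳ lo c ≡ b × σ ⟨$⟩ʳ hi c ≡ a)
        c↦pair = onto (touchesBoth c tc tp (λ e → p≢t (sym e))) tt'
          where
          onto : (t ≡ lo c × p ≡ hi c) ⊎ (t ≡ hi c × p ≡ lo c) → (t ≡ a × t' ≡ b) ⊎ (t ≡ b × t' ≡ a) →
                 (σ ⟨$⟩ʳ lo c ≡ a × σ ⟨$⟩ʳ hi c ≡ b) ⊎ (σ ⟨$⟩ʳ lo c ≡ b × σ ⟨$⟩ʳ hi c ≡ a)
          onto (inj₁ (refl , refl)) (inj₁ (ta , t'b)) = inj₁ (trans σt ta , trans σp t'b)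
          onto (inj₁ (refl , refl)) (inj₂ (tb , t'a)) = inj₂ (trans σt tb , trans σp t'a)
          onto (inj₂ (refl , refl)) (inj₁ (ta , t'b)) = inj₂ (trans σp t'b , trans σt ta)
          onto (inj₂ (refl , refl)) (inj₂ (tb , t'a)) = inj₁ (trans σp t'a , trans σt tb)
        has' : ContainsPairs L' (suc i)
        has' j j<1+i with ℕP.m≤n⇒m<n∨m≡n (ℕ.s≤s⁻¹ j<1+i)
        ... | inj₂ refl with pointwise-∈ images c∈L
        ...   | c' , c'∈ , im = let (l , h) = ImageOf-onto {σ = σ} {d = c} {d' = c'} im a b a<b c↦pair in
                                 c' , c'∈ , trans (cong toℕ l) (pairComp-lo i i<h) , trans (cong toℕ h) (pairComp-hi i i<h)
        has' j j<1+i | inj₁ j<i with has j j<i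
        ...   | d , d∈ , ld , hd with pointwise-∈ images d∈
        ...     | d' , d'∈ , im with fixesPair j j<i d d∈ (inj₁ ld) (inj₂ hd)
        ...       | fl , fh = let (l , h) = ImageOf-onto {σ = σ} {d = d} {d' = d'} im (lo d) (hi d) (lo<hi d) (inj₁ (fl , fh)) in
                              d' , d'∈ , trans (cong toℕ l) ld , trans (cong toℕ h) hd

      addPair : ∀ L M → SortingNetwork (L ∷ M) → ContainsPairs L i → NormalisedUpTo (suc i) L M
      addPair L M s has with any? (λ d → touches? d a) L | any? (λ d → touches? d b) L
      ... | no ¬ua | no ¬ub = addUnusedPair L M s has ¬ua ¬ub
      ... | yes ua | _ with find ua
      ...   | c , c∈L , ta with otherEnd c a ta
      ...     | p , tp , p≢a with p ≟ b
      ...       | no p≢b = swapIntoPair L M s has a b a∈pair b∈pair (FinP.<⇒≢ a<b) (inj₁ (refl , refl))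
                                        c c∈L ta p tp p≢a p≢b
      ...       | yes refl with touchesBoth c ta tp (FinP.<⇒≢ a<b)
      ...         | inj₁ (la , hb) = L , M , s , refl , containsPairs-extend c c∈L (sym la) (sym hb) has
      ...         | inj₂ (ha , lb) = ⊥-elim (ℕP.<-asym a<b (subst₂ Fin._<_ (sym lb) (sym ha) (lo<hi c)))
      addPair L M s has | no ¬ua | yes ub with find ub
      ...   | c , c∈L , tb with otherEnd c b tb
      ...     | p , tp , p≢b =
        swapIntoPair L M s has b a b∈pair a∈pair (λ e → FinP.<⇒≢ a<b (sym e)) (inj₂ (refl , refl))
                     c c∈L tb p tp p≢b (λ e → ¬ua (lose c∈L (subst (Touches c) e tp)))

    installPairs : ∀ k i → k + i ≡ n / 2 → ∀ L M → SortingNetwork (L ∷ M) → ContainsPairs L i →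
                   NormalisedUpTo (n / 2) L M
    installPairs zero    i refl L M s has = L , M , s , refl , has
    installPairs (suc k) i k+1+i≡h L M s has
      with AddPair.addPair i (subst (i ℕ.<_) k+1+i≡h (s≤s (ℕP.m≤n+m i k))) L M s has
    ... | L' , M' , s' , len' , has'
      with installPairs k (suc i) (trans (ℕP.+-suc k i) k+1+i≡h) L' M' s' has'
    ...   | L'' , M'' , s'' , len'' , has'' = L'' , M'' , s'' , trans len'' len' , has''

    -- A valid layer containing all pairs is F_n: any comparator of the layer
    -- shares its minimum channel with the pair comparator on that channel.
    allPairs⇒Fn : (L : Layer n) → ValidLayer L → ContainsPairs L (n / 2) → ∀ c → c ∈ L ⇔ InFn c
    allPairs⇒Fn L v has c = mk⇔ inFn member
      where
      member : InFn c → c ∈ L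
      member (i , i<h , l , h) with has i i<h
      ... | c₀ , c₀∈ , l₀ , h₀ =
        subst (_∈ L) (comparator-ext (FinP.toℕ-injective (trans l₀ (sym l)))
                                     (FinP.toℕ-injective (trans h₀ (sym h)))) c₀∈
      inFn : c ∈ L → InFn c
      inFn c∈ with pairIndex (lo c) (lo<2*[n/2] c)
      ... | j , j<h , lo∈j with has j j<h
      ...   | c₀ , c₀∈ , l₀ , h₀ with validLayer-unique v c∈ c₀∈ (inj₁ refl) (c₀-touches lo∈j)
        where
        c₀-touches : InPair j (lo c) → Touches c₀ (lo c)
        c₀-touches (inj₁ e) = inj₁ (FinP.toℕ-injective (trans l₀ (sym e)))
        c₀-touches (inj₂ e) = inj₂ (FinP.toℕ-injective (trans h₀ (sym e)))
      ...     | refl = j , j<h , l₀ , h₀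

    normaliseFirstLayer : (L : Layer n) (M : Network n) → SortingNetwork (L ∷ M) →
                          Σ (Network n) λ N → SortingNetwork N × depth N ≡ depth (L ∷ M) × FirstLayerIsFn N
    normaliseFirstLayer L M s with installPairs (n / 2) 0 (ℕP.+-identityʳ _) L M s (λ _ ())
    ... | L' , M' , s' , len , has = (L' ∷ M') , s' , cong suc len , allPairs⇒Fn L' (All.head (proj₁ s')) has

module FnLayer {n : ℕ} (A : Layer n) (isFn : ∀ c → c ∈ A ⇔ InFn c) where
  open Semantics
  open Pairs

  Covered : Fin n → Set
  Covered k = Uses A k

  covered? : ∀ k → Dec (Covered k)
  covered? k = any? (λ c → touches? c k) A

  covered⇒below : ∀ {k} → Covered k → toℕ k ℕ.< 2 * (n / 2)
  covered⇒below u with find u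
  ... | c , c∈ , t with Equivalence.to (isFn c) c∈
  ...   | i , i<h , l , h = ℕP.≤-<-trans (InPair-≤ {j = i} (inPair t)) (2j+1<2i i<h)
    where
    inPair : ∀ {k} → Touches c k → InPair i k
    inPair (inj₁ refl) = inj₁ l
    inPair (inj₂ refl) = inj₂ h

  below⇒covered : ∀ {k} → toℕ k ℕ.< 2 * (n / 2) → Covered k
  below⇒covered {k} k<2h with pairIndex k k<2h
  ... | j , j<h , k∈j =
    lose (Equivalence.from (isFn (pairComp j j<h)) (pairComp-InFn j j<h)) (pairComp-touches j j<h k∈j)

  lo-covered : ∀ (d : Comparator n) → Covered (lo d)
  lo-covered d = below⇒covered (lo<2*[n/2] d)

  uncovered-unique : ∀ {k k'} → ¬ Covered k → ¬ Covered k' → k ≡ k'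
  uncovered-unique {k} {k'} ¬ck ¬ck' = FinP.toℕ-injective (trans (is2h ¬ck) (sym (is2h ¬ck')))
    where
    is2h : ∀ {k} → ¬ Covered k → toℕ k ≡ 2 * (n / 2)
    is2h {k} ¬ck = ℕP.≤-antisym
      (ℕ.s≤s⁻¹ (subst (toℕ k ℕ.<_) (ℕP.+-comm (2 * (n / 2)) 1) (ℕP.<-≤-trans (FinP.toℕ<n k) (n≤2*[n/2]+1 n))))
      (ℕP.≮⇒≥ λ k<2h → ¬ck (below⇒covered k<2h))

module TwoLayerGraphs where
  open Semantics

  layer01 : ∀ (l : Fin 2) → l ≡ fz ⊎ l ≡ fs fz
  layer01 fz      = inj₁ refl
  layer01 (fs fz) = inj₂ refl

  module _ {n : ℕ} where

    labelOf : ∀ {c : Comparator n} {k} → Touches c k → Label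
    labelOf (inj₁ _) = one
    labelOf (inj₂ _) = two

    labelOf-out : ∀ {c : Comparator n} {k} (t : Touches c k) → outChannel (labelOf {c} t) c ≡ k
    labelOf-out (inj₁ e) = e
    labelOf-out (inj₂ e) = e

    touches-out : ∀ b (c : Comparator n) → Touches c (outChannel b c)
    touches-out one c = inj₁ refl
    touches-out two c = inj₂ refl

    labelOf-unique : ∀ b (c : Comparator n) (t : Touches c (outChannel b c)) → labelOf {c} t ≡ b
    labelOf-unique one c (inj₁ _) = refl
    labelOf-unique one c (inj₂ e) = ⊥-elim (lo≢hi c (sym e))
    labelOf-unique two c (inj₁ e) = ⊥-elim (lo≢hi c e)
    labelOf-unique two c (inj₂ _) = refl

    edgeIntoSecondLayer : ∀ (A B : Layer n) b p (v : Vertex (A ∷ B ∷ [])) → proj₁ v ≡ fs fz →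
                          Touches (compOf (A ∷ B ∷ []) v) (outChannel b (lookup A p)) →
                          Edge (A ∷ B ∷ []) b (fz , p) v
    edgeIntoSecondLayer A B b p (fs fz , q) refl t = s≤s z≤n , t , λ m 0<m m<1 _ → 1≰0 (ℕP.≤-trans 0<m (ℕ.s≤s⁻¹ m<1))
      where
      1≰0 : ¬ (1 ℕ.≤ 0)
      1≰0 ()

    noEdgeIntoFirstLayer : ∀ (A B : Layer n) b u (v : Vertex (A ∷ B ∷ [])) → proj₁ v ≡ fz →
                           ¬ Edge (A ∷ B ∷ []) b u v
    noEdgeIntoFirstLayer A B b u (fz , q) refl (() , _)

    compOf-first : ∀ (A B : Layer n) (u : Vertex (A ∷ B ∷ [])) → proj₁ u ≡ fz → compOf (A ∷ B ∷ []) u ∈ A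
    compOf-first A B (fz , p) refl = ∈-lookup p

    compOf-second : ∀ (A B : Layer n) (u : Vertex (A ∷ B ∷ [])) → proj₁ u ≡ fs fz → compOf (A ∷ B ∷ []) u ∈ B
    compOf-second A B (fs fz , p) refl = ∈-lookup p

module IsomorphicPrefixes
    {n : ℕ} (L₁ L₂ G₁ G₂ : Layer n) (vL₁ : ValidLayer L₁) (vL₂ : ValidLayer L₂) (vG₁ : ValidLayer G₁)
    (fnL : ∀ c → c ∈ L₁ ⇔ InFn c) (fnG : ∀ c → c ∈ G₁ ⇔ InFn c)
    (iso : (L₁ ∷ L₂ ∷ []) ≈ (G₁ ∷ G₂ ∷ [])) where
  open Semantics
  open Relabelling
  open TwoLayerGraphs

  -- Two isomorphic two-layer networks C = L₁;L₂ and D = G₁;G₂ with first layer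
  -- F_n differ only by a relabelling of channels: there is a permutation φ with
  -- relabelLayer φ L₁ = G₁ and, continuing with the renaming after L₁, the
  -- relabelled L₂ equal to G₂ (as sets of comparators).  φ sends the output
  -- channel b of a first-layer comparator u of C to the output channel b of
  -- its image F u, and fixes the (at most one) channel not covered by F_n.

  C D : Network n
  C = L₁ ∷ L₂ ∷ []
  D = G₁ ∷ G₂ ∷ []

  module CovC = FnLayer L₁ fnL
  module CovD = FnLayer G₁ fnG

  F : Vertex C → Vertex D
  F = Bijection.to (proj₁ iso)

  F⁻¹ : Vertex D → Vertex C
  F⁻¹ w = proj₁ (Bijection.surjective (proj₁ iso) w)

  F-F⁻¹ : ∀ w → F (F⁻¹ w) ≡ w
  F-F⁻¹ w = proj₂ (Bijection.surjective (proj₁ iso) w) refl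

  F⁻¹-F : ∀ u → F⁻¹ (F u) ≡ u
  F⁻¹-F u = Bijection.injective (proj₁ iso) (F-F⁻¹ (F u))

  edgeTo : ∀ b u v → Edge C b u v → Edge D b (F u) (F v)
  edgeTo b u v = Equivalence.to (proj₂ iso b u v)

  edgeFrom : ∀ b u v → Edge D b (F u) (F v) → Edge C b u v
  edgeFrom b u v = Equivalence.from (proj₂ iso b u v)

  -- F preserves layers: only second-layer vertices have incoming edges, and
  -- each of them has one, since its minimum channel is covered by F_n.
  incoming : ∀ (A B : Layer n) (fnA : ∀ c → c ∈ A ⇔ InFn c) (v : Vertex (A ∷ B ∷ [])) → proj₁ v ≡ fs fz →
             Σ (Fin (length A)) λ p → Σ Label λ b → Edge (A ∷ B ∷ []) b (fz , p) v
  incoming A B fnA v v∈1 with FnLayer.lo-covered A fnA (compOf (A ∷ B ∷ []) v)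
  ... | u = Any.index u , labelOf t , edgeIntoSecondLayer A B (labelOf t) (Any.index u) v v∈1 (inj₁ (sym (labelOf-out t)))
    where
    t = lookup-index u

  noIncomingD : ∀ u → proj₁ u ≡ fz → ¬ proj₁ (F u) ≡ fs fz
  noIncomingD u u∈0 Fu∈1 =
    let (p , b , e) = incoming G₁ G₂ fnG (F u) Fu∈1
        e' = subst (λ w → Edge D b w (F u)) (sym (F-F⁻¹ (fz , p))) e
    in noEdgeIntoFirstLayer L₁ L₂ b (F⁻¹ (fz , p)) u u∈0 (edgeFrom b (F⁻¹ (fz , p)) u e')

  noIncomingC : ∀ w → proj₁ w ≡ fz → ¬ proj₁ (F⁻¹ w) ≡ fs fz
  noIncomingC w w∈0 u∈1 =
    let (p , b , e) = incoming L₁ L₂ fnL (F⁻¹ w) u∈1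
        e' = subst (Edge D b (F (fz , p))) (F-F⁻¹ w) (edgeTo b (fz , p) (F⁻¹ w) e)
    in noEdgeIntoFirstLayer G₁ G₂ b (F (fz , p)) w w∈0 e'

  F-first : ∀ u → proj₁ u ≡ fz → proj₁ (F u) ≡ fz
  F-first u u∈0 = [ id , (λ Fu∈1 → ⊥-elim (noIncomingD u u∈0 Fu∈1)) ]′ (layer01 (proj₁ (F u)))

  F⁻¹-first : ∀ w → proj₁ w ≡ fz → proj₁ (F⁻¹ w) ≡ fz
  F⁻¹-first w w∈0 = [ id , (λ u∈1 → ⊥-elim (noIncomingC w w∈0 u∈1)) ]′ (layer01 (proj₁ (F⁻¹ w)))

  0≢1 : Fin.zero {1} ≢ fs fz
  0≢1 ()

  F-second : ∀ v → proj₁ v ≡ fs fz → proj₁ (F v) ≡ fs fz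
  F-second v v∈1 with layer01 (proj₁ (F v))
  ... | inj₂ Fv∈1 = Fv∈1
  ... | inj₁ Fv∈0 = ⊥-elim (0≢1 (trans (sym (F⁻¹-first (F v) Fv∈0)) (trans (cong proj₁ (F⁻¹-F v)) v∈1)))

  F⁻¹-second : ∀ w → proj₁ w ≡ fs fz → proj₁ (F⁻¹ w) ≡ fs fz
  F⁻¹-second w w∈1 with layer01 (proj₁ (F⁻¹ w))
  ... | inj₂ u∈1 = u∈1
  ... | inj₁ u∈0 = ⊥-elim (0≢1 (trans (sym (F-first (F⁻¹ w) u∈0)) (trans (cong proj₁ (F-F⁻¹ w)) w∈1)))

  -- A covered
  -- channel is reached by a unique first-layer comparator with a unique label.
  -- Kept abstract: only the characterising equations below are used.
  abstract
    φ : Fin n → Fin n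
    φ k with CovC.covered? k
    ... | yes u = outChannel (labelOf {c = lookup L₁ (Any.index u)} (lookup-index u)) (compOf D (F (fz , Any.index u)))
    ... | no _  = k

    ψ : Fin n → Fin n
    ψ k with CovD.covered? k
    ... | yes u = outChannel (labelOf {c = lookup G₁ (Any.index u)} (lookup-index u)) (compOf C (F⁻¹ (fz , Any.index u)))
    ... | no _  = k

    φ-out : ∀ p b → φ (outChannel b (lookup L₁ p)) ≡ outChannel b (compOf D (F (fz , p)))
    φ-out p b with CovC.covered? (outChannel b (lookup L₁ p))
    ... | yes u = samePosition (Any.index u) (lookup-index u)
      where
      samePosition : ∀ p' (t : Touches (lookup L₁ p') (outChannel b (lookup L₁ p))) →
                     outChannel (labelOf {c = lookup L₁ p'} t) (compOf D (F (fz , p'))) ≡ outChannel b (compOf D (F (fz , p)))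
      samePosition p' t with validLayer-uniquePos {L = L₁} vL₁ {p'} {p} t (touches-out b (lookup L₁ p))
      ... | refl = cong (λ l → outChannel l (compOf D (F (fz , p)))) (labelOf-unique b (lookup L₁ p) t)
    ... | no ¬u = ⊥-elim (¬u (lose (∈-lookup p) (touches-out b (lookup L₁ p))))

    ψ-out : ∀ p b → ψ (outChannel b (lookup G₁ p)) ≡ outChannel b (compOf C (F⁻¹ (fz , p)))
    ψ-out p b with CovD.covered? (outChannel b (lookup G₁ p))
    ... | yes u = samePosition (Any.index u) (lookup-index u)
      where
      samePosition : ∀ p' (t : Touches (lookup G₁ p') (outChannel b (lookup G₁ p))) →
                     outChannel (labelOf {c = lookup G₁ p'} t) (compOf C (F⁻¹ (fz , p'))) ≡
                     outChannel b (compOf C (F⁻¹ (fz , p)))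
      samePosition p' t with validLayer-uniquePos {L = G₁} vG₁ {p'} {p} t (touches-out b (lookup G₁ p))
      ... | refl = cong (λ l → outChannel l (compOf C (F⁻¹ (fz , p)))) (labelOf-unique b (lookup G₁ p) t)
    ... | no ¬u = ⊥-elim (¬u (lose (∈-lookup p) (touches-out b (lookup G₁ p))))

    φ-uncovered : ∀ k → ¬ CovC.Covered k → φ k ≡ k
    φ-uncovered k ¬ck with CovC.covered? k
    ... | yes ck = ⊥-elim (¬ck ck)
    ... | no _   = refl

    ψ-uncovered : ∀ k → ¬ CovD.Covered k → ψ k ≡ k
    ψ-uncovered k ¬ck with CovD.covered? k
    ... | yes ck = ⊥-elim (¬ck ck)
    ... | no _   = refl

  coveredC⇒D : ∀ {k} → CovC.Covered k → CovD.Covered k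
  coveredC⇒D ck = CovD.below⇒covered (CovC.covered⇒below ck)

  coveredD⇒C : ∀ {k} → CovD.Covered k → CovC.Covered k
  coveredD⇒C ck = CovC.below⇒covered (CovD.covered⇒below ck)

  φ-outOf : ∀ u → proj₁ u ≡ fz → ∀ b → φ (outChannel b (compOf C u)) ≡ outChannel b (compOf D (F u))
  φ-outOf (fz , p) refl = φ-out p

  ψ-outOf : ∀ w → proj₁ w ≡ fz → ∀ b → ψ (outChannel b (compOf D w)) ≡ outChannel b (compOf C (F⁻¹ w))
  ψ-outOf (fz , p) refl = ψ-out p

  ψ-φ : ∀ k → ψ (φ k) ≡ k
  ψ-φ k with CovC.covered? k
  ... | no ¬ck = trans (cong ψ (φ-uncovered k ¬ck)) (ψ-uncovered k (λ ck → ¬ck (coveredD⇒C ck)))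
  ... | yes u = begin
    ψ (φ k)                                        ≡⟨ cong (ψ ∘′ φ) (labelOf-out t) ⟨
    ψ (φ (outChannel b (lookup L₁ p)))             ≡⟨ cong ψ (φ-out p b) ⟩
    ψ (outChannel b (compOf D (F (fz , p))))       ≡⟨ ψ-outOf (F (fz , p)) (F-first _ refl) b ⟩
    outChannel b (compOf C (F⁻¹ (F (fz , p))))     ≡⟨ cong (λ u → outChannel b (compOf C u)) (F⁻¹-F (fz , p)) ⟩
    outChannel b (lookup L₁ p)                     ≡⟨ labelOf-out t ⟩
    k                                              ∎
    where
    open ≡-Reasoning
    p = Any.index u
    t = lookup-index u
    b = labelOf {c = lookup L₁ p} t

  φ-ψ : ∀ k → φ (ψ k) ≡ k
  φ-ψ k with CovD.covered? k
  ... | no ¬ck = trans (cong φ (ψ-uncovered k ¬ck)) (φ-uncovered k (λ ck → ¬ck (coveredC⇒D ck)))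
  ... | yes u = begin
    φ (ψ k)                                        ≡⟨ cong (φ ∘′ ψ) (labelOf-out t) ⟨
    φ (ψ (outChannel b (lookup G₁ p)))             ≡⟨ cong φ (ψ-out p b) ⟩
    φ (outChannel b (compOf C (F⁻¹ (fz , p))))     ≡⟨ φ-outOf (F⁻¹ (fz , p)) (F⁻¹-first _ refl) b ⟩
    outChannel b (compOf D (F (F⁻¹ (fz , p))))     ≡⟨ cong (λ w → outChannel b (compOf D w)) (F-F⁻¹ (fz , p)) ⟩
    outChannel b (lookup G₁ p)                     ≡⟨ labelOf-out t ⟩
    k                                              ∎
    where
    open ≡-Reasoning
    p = Any.index u
    t = lookup-index u
    b = labelOf {c = lookup G₁ p} t

  φP : Permutation′ n
  φP = permutation φ ψ φ-ψ ψ-φ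

  -- The first layer.  φ maps each comparator of L₁ onto its image comparator
  -- in G₁ with the same orientation, so relabelling L₁ by φ reverses nothing:
  -- it produces exactly G₁ and leaves the renaming φ unchanged.
  φ-orients : ∀ c → c ∈ L₁ → φ (lo c) Fin.< φ (hi c)
  φ-orients c c∈ with Any.index c∈ | lookup-index c∈
  ... | p | refl = subst₂ Fin._<_ (sym (φ-out p one)) (sym (φ-out p two)) (lo<hi (compOf D (F (fz , p))))

  relabelLayer-orienting : ∀ (σ : Permutation′ n) (L : Layer n) →
                           (∀ c → c ∈ L → σ ⟨$⟩ʳ lo c Fin.< σ ⟨$⟩ʳ hi c) →
                           ∀ v → proj₂ (relabelLayer σ L) ⟨$⟩ʳ v ≡ σ ⟨$⟩ʳ v
  relabelLayer-orienting σ []      orients v = refl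
  relabelLayer-orienting σ (c ∷ L) orients v with relabelStep σ c
  ... | (c' , σ') , inj₁ (_ , _ , σ'≗σ) =
    trans (relabelLayer-orienting σ' L
             (λ d d∈ → subst₂ Fin._<_ (sym (σ'≗σ (lo d))) (sym (σ'≗σ (hi d))) (orients d (there d∈))) v)
          (σ'≗σ v)
  ... | (c' , σ') , inj₂ (l , h , _) =
    ⊥-elim (ℕP.<-asym (orients c (here refl)) (subst₂ Fin._<_ l h (lo<hi c')))

  σ₁ : Permutation′ n
  σ₁ = proj₂ (relabelLayer φP L₁)

  σ₁≗φ : ∀ v → σ₁ ⟨$⟩ʳ v ≡ φ v
  σ₁≗φ = relabelLayer-orienting φP L₁ φ-orients

  image-first : ∀ p {c'} → ImageOf φP (lookup L₁ p) c' → c' ≡ compOf D (F (fz , p))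
  image-first p {c'} im = comparator-ext (proj₁ onto) (proj₂ onto)
    where
    e = compOf D (F (fz , p))
    onto = ImageOf-onto {σ = φP} {d = lookup L₁ p} {d' = c'} im (lo e) (hi e) (lo<hi e) (inj₁ (φ-out p one , φ-out p two))

  image-first⁻¹ : ∀ p {c'} → ImageOf φP (compOf C (F⁻¹ (fz , p))) c' → c' ≡ lookup G₁ p
  image-first⁻¹ p {c'} im = comparator-ext (proj₁ onto) (proj₂ onto)
    where
    u = F⁻¹ (fz , p)
    φ-onto : ∀ b → φ (outChannel b (compOf C u)) ≡ outChannel b (lookup G₁ p)
    φ-onto b = trans (φ-outOf u (F⁻¹-first _ refl) b) (cong (λ w → outChannel b (compOf D w)) (F-F⁻¹ (fz , p)))
    onto = ImageOf-onto {σ = φP} {d = compOf C u} {d' = c'} im (lo (lookup G₁ p)) (hi (lookup G₁ p))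
                        (lo<hi (lookup G₁ p)) (inj₁ (φ-onto one , φ-onto two))

  firstLayer-same : SameComparators (proj₁ (relabelLayer φP L₁)) G₁
  firstLayer-same c' = toG₁ , fromG₁
    where
    images = relabelLayer-image φP L₁ vL₁
    toG₁ : c' ∈ proj₁ (relabelLayer φP L₁) → c' ∈ G₁
    toG₁ c'∈ =
      let (c , c∈ , im) = pointwise-∈' images c'∈
          p = Any.index c∈
      in subst (_∈ G₁) (sym (image-first p (subst (λ d → ImageOf φP d c') (lookup-index c∈) im)))
               (compOf-first G₁ G₂ (F (fz , p)) (F-first _ refl))
    fromG₁ : c' ∈ G₁ → c' ∈ proj₁ (relabelLayer φP L₁)
    fromG₁ c'∈ =
      let p = Any.index c'∈
          (c'' , c''∈ , im) = pointwise-∈ images (compOf-first L₁ L₂ (F⁻¹ (fz , p)) (F⁻¹-first _ refl))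
      in subst (_∈ proj₁ (relabelLayer φP L₁)) (trans (image-first⁻¹ p im) (sym (lookup-index c'∈))) c''∈

  -- Let v be a second-layer vertex of C, c its comparator
  -- and e the comparator of F v.  Covered channels are outputs of first-layer
  -- comparators, so edges transport them: φ sends covered channels of c to
  -- channels of e, and ψ sends covered channels of e to channels of c.
  φ-touches : ∀ v → proj₁ v ≡ fs fz → ∀ k → Touches (compOf C v) k → CovC.Covered k →
              Touches (compOf D (F v)) (φ k)
  φ-touches v v∈1 k tk ck =
    subst (Touches (compOf D (F v))) (trans (sym (φ-out p b)) (cong φ out≡k)) (proj₁ (proj₂ (edgeTo b (fz , p) v edgeC)))
    where
    p = Any.index ck
    t = lookup-index ck
    b = labelOf {c = lookup L₁ p} t
    out≡k : outChannel b (lookup L₁ p) ≡ k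
    out≡k = labelOf-out {c = lookup L₁ p} t
    edgeC : Edge C b (fz , p) v
    edgeC = edgeIntoSecondLayer L₁ L₂ b p v v∈1 (subst (Touches (compOf C v)) (sym out≡k) tk)

  ψ-touches : ∀ v → proj₁ v ≡ fs fz → ∀ y → Touches (compOf D (F v)) y → CovD.Covered y →
              Touches (compOf C v) (ψ y) × CovC.Covered (ψ y)
  ψ-touches v v∈1 y ty cy =
    subst (Touches (compOf C v)) (sym ψy≡) (proj₁ (proj₂ edgeC)) ,
    subst CovC.Covered (sym ψy≡) (lose (compOf-first L₁ L₂ u (F⁻¹-first _ refl)) (touches-out b (compOf C u)))
    where
    p = Any.index cy
    t = lookup-index cy
    b = labelOf {c = lookup G₁ p} t
    out≡y : outChannel b (lookup G₁ p) ≡ y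
    out≡y = labelOf-out {c = lookup G₁ p} t
    u = F⁻¹ (fz , p)
    edgeD : Edge D b (fz , p) (F v)
    edgeD = edgeIntoSecondLayer G₁ G₂ b p (F v) (F-second v v∈1) (subst (Touches (compOf D (F v))) (sym out≡y) ty)
    edgeC : Edge C b u v
    edgeC = edgeFrom b u v (subst (λ w → Edge D b w (F v)) (sym (F-F⁻¹ (fz , p))) edgeD)
    ψy≡ : ψ y ≡ outChannel b (compOf C u)
    ψy≡ = trans (cong ψ (sym out≡y)) (ψ-out p b)

  MapsOnto : Comparator n → Comparator n → Set
  MapsOnto c e = (φ (lo c) ≡ lo e × φ (hi c) ≡ hi e) ⊎ (φ (lo c) ≡ hi e × φ (hi c) ≡ lo e)

  -- If the maximum channel of c is the uncovered channel, then the other end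
  -- of e is uncovered as well (a covered one would pull back to lo c), so
  -- both are the uncovered channel, which φ fixes.
  otherEnd-uncovered : ∀ v → proj₁ v ≡ fs fz → ¬ CovC.Covered (hi (compOf C v)) →
                       ∀ y → Touches (compOf D (F v)) y → y ≢ φ (lo (compOf C v)) → y ≡ φ (hi (compOf C v))
  otherEnd-uncovered v v∈1 ¬ch y ty y≢ with CovD.covered? y
  ... | no ¬cy = trans (CovD.uncovered-unique ¬cy (λ ch → ¬ch (coveredD⇒C ch))) (sym (φ-uncovered _ ¬ch))
  ... | yes cy = ⊥-elim (y≢ (trans (sym (φ-ψ y)) (cong φ ψy≡lo)))
    where
    c = compOf C v
    touch = ψ-touches v v∈1 y ty cy
    ψy≡lo : ψ y ≡ lo c
    ψy≡lo with proj₁ touch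
    ... | inj₁ lo≡ = sym lo≡
    ... | inj₂ hi≡ = ⊥-elim (¬ch (subst CovC.Covered (sym hi≡) (proj₂ touch)))

  secondLayer-onto : ∀ v → proj₁ v ≡ fs fz → MapsOnto (compOf C v) (compOf D (F v))
  secondLayer-onto v v∈1 = byMaxChannel (CovC.covered? (hi c))
    where
    c = compOf C v
    e = compOf D (F v)
    tlo : Touches e (φ (lo c))
    tlo = φ-touches v v∈1 (lo c) (inj₁ refl) (CovC.lo-covered c)
    byMaxChannel : Dec (CovC.Covered (hi c)) → MapsOnto c e
    byMaxChannel (yes ch) = touchesBoth e tlo (φ-touches v v∈1 (hi c) (inj₂ refl) ch) (λ q → lo≢hi c (perm-injective φP q))
    byMaxChannel (no ¬ch) =
      let (y , ty , y≢) = otherEnd e (φ (lo c)) tlo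
      in subst (λ z → (φ (lo c) ≡ lo e × z ≡ hi e) ⊎ (φ (lo c) ≡ hi e × z ≡ lo e))
               (otherEnd-uncovered v v∈1 ¬ch y ty y≢) (touchesBoth e tlo ty (λ q → y≢ (sym q)))

  secondLayer-same : SameComparators (proj₁ (relabelLayer σ₁ L₂)) G₂
  secondLayer-same c' = toG₂ , fromG₂
    where
    images = relabelLayer-image σ₁ L₂ vL₂
    asφ : ∀ {c c'} → ImageOf σ₁ c c' → ImageOf φP c c'
    asφ {c} {c'} = ImageOf-cong {σ = φP} {τ = σ₁} {c = c} {c' = c'} (σ₁≗φ (lo c)) (σ₁≗φ (hi c))
    image-second : ∀ v → proj₁ v ≡ fs fz → ∀ {c'} → ImageOf σ₁ (compOf C v) c' → c' ≡ compOf D (F v)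
    image-second v v∈1 {c'} im =
      let e = compOf D (F v)
          (l , h) = ImageOf-onto {σ = φP} {d = compOf C v} {d' = c'} (asφ {compOf C v} {c'} im)
                                 (lo e) (hi e) (lo<hi e) (secondLayer-onto v v∈1)
      in comparator-ext l h
    toG₂ : c' ∈ proj₁ (relabelLayer σ₁ L₂) → c' ∈ G₂
    toG₂ c'∈ =
      let (c , c∈ , im) = pointwise-∈' images c'∈
          v = (fs fz , Any.index c∈)
      in subst (_∈ G₂) (sym (image-second v refl (subst (λ d → ImageOf σ₁ d c') (lookup-index c∈) im)))
               (compOf-second G₁ G₂ (F v) (F-second v refl))
    fromG₂ : c' ∈ G₂ → c' ∈ proj₁ (relabelLayer σ₁ L₂)
    fromG₂ c'∈ =
      let w = (fs fz , Any.index c'∈)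
          v = F⁻¹ w
          (c'' , c''∈ , im) = pointwise-∈ images (compOf-second L₁ L₂ v (F⁻¹-second w refl))
      in subst (_∈ proj₁ (relabelLayer σ₁ L₂))
               (trans (image-second v (F⁻¹-second w refl) im)
                      (trans (cong (compOf D) (F-F⁻¹ w)) (sym (lookup-index c'∈)))) c''∈

  -- Consequently any sorting network with prefix C can be rewritten, at the
  -- same depth, into one with prefix D: relabel it by φ and replace its first
  -- two layers by G₁ and G₂.
  prefixExchange : (M : Network n) → SortingNetwork (L₁ ∷ L₂ ∷ M) → ValidLayer G₂ →
                   Σ (Network n) λ M' → SortingNetwork (G₁ ∷ G₂ ∷ M') × depth M' ≡ depth M
  prefixExchange M sorting vG₂ =
    M' , replaceTwoLayers _ _ G₁ G₂ M' (relabel-sorting φP (L₁ ∷ L₂ ∷ M) sorting)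
                          vG₁ vG₂ firstLayer-same secondLayer-same
       , relabelNetwork-length _ M
    where
    M' = proj₁ (relabelNetwork (proj₂ (relabelLayer σ₁ L₂)) M)

module LowerBounds where
  open Semantics

  module _ {m : ℕ} where

    emptyNotSorting : ¬ (∀ x → Sorted (run {2 + m} [] x))
    emptyNotSorting sorts = 1≰0 (sorts x fz (fs fz) z≤n)
      where
      x : Fin (2 + m) → ℕ
      x fz     = 1
      x (fs _) = 0
      1≰0 : ¬ (1 ℕ.≤ 0)
      1≰0 ()

    -- On three or more channels the single layer F_n does not sort: on the
    -- input with a 1 on channel 1 and 0 elsewhere, the comparator (0, 1) keeps
    -- the 1 on channel 1 while channel 2 only meets zeros.
    fnLayerNotSorting : (L : Layer (3 + m)) → ValidLayer L → (∀ c → c ∈ L ⇔ InFn c) →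
                        ¬ (∀ x → Sorted (applyLayer L x))
    fnLayerNotSorting L v isFn sorts = 1≰0 (subst₂ ℕ._≤_ out₁ out₂ (sorts x (fs fz) ch₂ (s≤s z≤n)))
      where
      1≰0 : ¬ (1 ℕ.≤ 0)
      1≰0 ()
      ch₂ : Fin (3 + m)
      ch₂ = fs (fs fz)
      pair₀ : Comparator (3 + m)
      pair₀ = cmp fz (fs fz) (s≤s z≤n)
      pair₀∈L : pair₀ ∈ L
      pair₀∈L = Equivalence.from (isFn pair₀) (0 , DivMod.m≥n⇒m/n>0 {3 + m} {2} (s≤s (s≤s z≤n)) , refl , refl)
      x : Fin (3 + m) → ℕ
      x fz           = 0
      x (fs fz)      = 1
      x (fs (fs _))  = 0
      x-vanishes : ∀ k → k ≢ fs fz → x k ≡ 0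
      x-vanishes fz           _   = refl
      x-vanishes (fs fz)      k≢1 = ⊥-elim (k≢1 refl)
      x-vanishes (fs (fs _))  _   = refl
      out₁ : applyLayer L x (fs fz) ≡ 1
      out₁ = applyLayer-hi L v pair₀∈L x
      -- The comparator d on channel 2 (if any) is not pair₀, hence avoids channel 1.
      onChannel₂ : ∀ {d} → d ∈ L → Touches d ch₂ → applyLayer L x ch₂ ≡ 0
      onChannel₂ {d} d∈ t = output t
        where
        pair₀-avoids₂ : ¬ Touches pair₀ ch₂
        pair₀-avoids₂ (inj₁ ())
        pair₀-avoids₂ (inj₂ ())
        avoids₁ : ∀ {k} → Touches d k → k ≢ fs fz
        avoids₁ tk refl =
          pair₀-avoids₂ (subst (λ c → Touches c ch₂) (validLayer-unique v d∈ pair₀∈L tk (inj₂ refl)) t)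
        zeros : x (lo d) ⊓ x (hi d) ≡ 0 × x (lo d) ⊔ x (hi d) ≡ 0
        zeros rewrite x-vanishes (lo d) (avoids₁ (inj₁ refl)) | x-vanishes (hi d) (avoids₁ (inj₂ refl)) = refl , refl
        output : Touches d ch₂ → applyLayer L x ch₂ ≡ 0
        output (inj₁ refl) = trans (applyLayer-lo L v d∈ x) (proj₁ zeros)
        output (inj₂ refl) = trans (applyLayer-hi L v d∈ x) (proj₂ zeros)
      out₂ : applyLayer L x ch₂ ≡ 0
      out₂ with any? (λ c → touches? c ch₂) L
      ... | no ¬u = applyLayer-untouched L x ch₂ ¬u
      ... | yes u = let (d , d∈ , t) = find u in onChannel₂ d∈ t

open OptimalNetworks
open FirstLayer
open LowerBounds

-- On n ≥ 3 channels some optimal sorting network has at least two layers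
-- and first layer F_n: normalise the first layer of any optimal network.
OptimalWithFnPrefix : (n : ℕ) → Set
OptimalWithFnPrefix n = Σ (Layer n) λ L₁ → Σ (Layer n) λ L₂ → Σ (Network n) λ M →
                        OptimalSortingNetwork n (L₁ ∷ L₂ ∷ M) × FirstLayerIsFn (L₁ ∷ L₂ ∷ M)

optimalWithFnFirstLayer : ∀ m → OptimalWithFnPrefix (3 + m)
optimalWithFnFirstLayer m = normalised (proj₁ optimal) (proj₂ optimal)
  where
  optimal = optimalSortingNetwork (3 + m)
  atLeastTwoLayers : (N : Network (3 + m)) → SortingNetwork N → FirstLayerIsFn N →
                     (∀ (D : Network (3 + m)) → SortingNetwork D → depth N ℕ.≤ depth D) →
                     OptimalWithFnPrefix (3 + m)
  atLeastTwoLayers (L₁ ∷ [])      s fn _       = ⊥-elim (fnLayerNotSorting {m} L₁ (All.head (proj₁ s)) fn (proj₂ s))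
  atLeastTwoLayers (L₁ ∷ L₂ ∷ M) s fn minimal = L₁ , L₂ , M , (s , minimal) , fn
  normalised : (N : Network (3 + m)) → OptimalSortingNetwork (3 + m) N → OptimalWithFnPrefix (3 + m)
  normalised []      (s , _)       = ⊥-elim (emptyNotSorting {suc m} (proj₂ s))
  normalised (L ∷ M) (s , minimal) =
    let (N' , s' , sameDepth , fn) = normaliseFirstLayer L M s
    in atLeastTwoLayers N' s' fn (λ D sD → subst (ℕ._≤ depth D) (sym sameDepth) (minimal D sD))

-- If C = L₁;L₂ is the prefix of an optimal sorting network C;M with first
-- layer F_n, then every representative D of the class of C is a filter:
-- by the prefix exchange, D;M' is a sorting network of the same depth.
representativeIsFilter : ∀ {n} (R : Network n → Set) (L₁ L₂ : Layer n) (M : Network n) →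
                         OptimalSortingNetwork n (L₁ ∷ L₂ ∷ M) → FirstLayerIsFn (L₁ ∷ L₂ ∷ M) →
                         (D : Network n) → R D → TwoLayerFn D → (L₁ ∷ L₂ ∷ []) ≈ D → CompleteFilters R
representativeIsFilter R L₁ L₂ M (s , minimal) fnL (G₁ ∷ G₂ ∷ []) RD ((vG₁ ∷ vG₂ ∷ []) , refl , fnG) C≈D =
  (G₁ ∷ G₂ ∷ []) , M' , RD , s' , λ D' sD' → subst (ℕ._≤ depth D') (cong (2 +_) (sym sameDepth)) (minimal D' sD')
  where
  vL = proj₁ s
  exchanged = IsomorphicPrefixes.prefixExchange L₁ L₂ G₁ G₂ (All.head vL) (All.head (All.tail vL)) vG₁
                                                fnL fnG C≈D M s vG₂
  M' = proj₁ exchanged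
  s' = proj₁ (proj₂ exchanged)
  sameDepth = proj₂ (proj₂ exchanged)
representativeIsFilter R L₁ L₂ M _ _ []                  _ (_ , () , _) _
representativeIsFilter R L₁ L₂ M _ _ (_ ∷ [])            _ (_ , () , _) _
representativeIsFilter R L₁ L₂ M _ _ (_ ∷ _ ∷ _ ∷ _)     _ (_ , () , _) _

-- The theorem: a set R of representatives of the ≈-classes of two-layer
-- networks with first layer F_n is a complete set of filters.
theorem1 : (n : ℕ) → n ≥ 3 → (R : Network n → Set) →
    (∀ C → R C → TwoLayerFn C) →
    (∀ C → TwoLayerFn C → Σ (Network n) λ D → R D × (C ≈ D)) →
    (∀ D D' → R D → R D' → D ≈ D' → SameNetwork D D') →
    CompleteFilters R
theorem1 (suc (suc (suc m))) (s≤s (s≤s (s≤s z≤n))) R R⇒Fn representative _ =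
  let (L₁ , L₂ , M , optimal , fn) = optimalWithFnFirstLayer m
      vL = proj₁ (proj₁ optimal)
      prefixIsFn : TwoLayerFn (L₁ ∷ L₂ ∷ [])
      prefixIsFn = (All.head vL ∷ All.head (All.tail vL) ∷ []) , refl , fn
      (D , RD , C≈D) = representative (L₁ ∷ L₂ ∷ []) prefixIsFn
  in representativeIsFilter R L₁ L₂ M optimal fn D RD (R⇒Fn D RD) C≈D
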